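{- Let $R_1=1+xq$ and, for $r\ge 2$, $R_r = 1+xq^r - \dfrac{x^2q^{2r-1}}{R_{r-1}}$ (rational functions of $x,q$). Then for every integer $N\ge1$, \[ \frac{F_N(0,1,1;x)}{F_{N-1}(0,1,1;x)} = R_N, \] i.e. $\dfrac{F_N(0,1,1;x)}{F_{N-1}(0,1,1;x)}=1+xq^N-\cfrac{x^2q^{2N-1}}{1+xq^{N-1}-\cfrac{x^2q^{2N-3}}{\ddots-\cfrac{x^2q^{3}}{1+xq}}}$.
   Context: Gaussian binomial: ${A\brack B}_q=0$ if $B>A$ or $B<0$, otherwise $\frac{(q;q)_A}{(q;q)_B(q;q)_{A-B}}$, with $(a;q)_n=\prod_{t=0}^{n-1}(1-aq^t)$. For integers $N$, $F_N(0,1,1;x)=0$ if $N<0$, and for $N\ge0$ \[ F_N(0,1,1;x)=\sum_{m,n\ge0}(-1)^n q^{\binom{3n+1}{2}+m^2+3mn}x^{m+3n}{N-3n-m+1\brack m}_q{N-2n-m\brack n}_{q^3}. \] -}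

module Defs where

open import Data.Nat as ℕ using (ℕ; zero; suc; _∸_; _≤?_)
open import Data.Integer as ℤ using (ℤ; +_; -[1+_])
open import Data.Rational using (ℚ; 0ℚ; 1ℚ; _+_; _*_; _-_; -_; 1/_; ≢-nonZero)
open import Data.Rational.Properties using (_≟_)
open import Relation.Nullary using (yes; no)

infixr 8 _^_
_^_ : ℚ → ℕ → ℚ
p ^ zero  = 1ℚ
p ^ suc n = p * p ^ n

-- reciprocal, only used at nonzero arguments (hypotheses guarantee this);
-- conventionally 0 at 0
inv : ℚ → ℚ
inv p with p ≟ 0ℚ
... | yes _  = 0ℚ
... | no p≢0 = 1/_ p {{≢-nonZero p≢0}}

poch : ℚ → ℚ → ℕ → ℚ
poch a q zero    = 1ℚ
poch a q (suc n) = poch a q n * (1ℚ - a * q ^ n)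

qfac : ℚ → ℕ → ℚ
qfac q n = poch q q n

gaussNat : ℚ → ℕ → ℕ → ℚ
gaussNat q a b with b ≤? a
... | no _  = 0ℚ
... | yes _ = qfac q a * inv (qfac q b * qfac q (a ∸ b))

gauss : ℚ → ℤ → ℤ → ℚ
gauss q A -[1+ _ ] = 0ℚ
gauss q (-[1+ _ ]) (+ b) = 0ℚ
gauss q (+ a) (+ b) = gaussNat q a b

sumTo : ℕ → (ℕ → ℚ) → ℚ
sumTo zero    f = f zero
sumTo (suc k) f = sumTo k f + f (suc k)

binom2 : ℕ → ℕ
binom2 k = (k ℕ.* (k ∸ 1)) ℕ./ 2

term : ℚ → ℚ → ℕ → ℕ → ℕ → ℚ
term x q N m n =
  ((- 1ℚ) ^ n) * (q ^ (binom2 (3 ℕ.* n ℕ.+ 1) ℕ.+ m ℕ.* m ℕ.+ 3 ℕ.* m ℕ.* n))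
  * (x ^ (m ℕ.+ 3 ℕ.* n))
  * gauss q (+ N ℤ.- + (3 ℕ.* n) ℤ.- + m ℤ.+ + 1) (+ m)
  * gauss (q ^ 3) (+ N ℤ.- + (2 ℕ.* n) ℤ.- + m) (+ n)

-- F_N(0,1,1;x) for N ≥ 0.  The sum over m,n ≥ 0 is finite: for m > N+1 or
-- n > N one of the Gaussian binomials vanishes, so summing m ≤ N+1, n ≤ N
-- gives exactly the full sum.
F : ℚ → ℚ → ℕ → ℚ
F x q N = sumTo (suc N) (λ m → sumTo N (λ n → term x q N m n))

-- R_1 = 1 + x q,  R_r = 1 + x q^r - x^2 q^{2r-1} / R_{r-1}  (r ≥ 2);
-- R_0 is not used (set to 1).
R : ℚ → ℚ → ℕ → ℚ
R x q zero = 1ℚ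
R x q (suc zero) = 1ℚ + x * q
R x q (suc (suc r)) =
  1ℚ + x * q ^ (suc (suc r))
  - (x ^ 2 * q ^ (2 ℕ.* r ℕ.+ 3)) * inv (R x q (suc r))

{-# OPTIONS --safe #-}
-- Write the summand of F_N as t_N(m,n) x^{m+3n} with t_N(m,n) = ±q^e [a, m]_q [c, n]_{q³},
-- a = N - 3n - m + 1, c = N - 2n - m.  Expanding [a, m] three times and [c, n] once by
-- q-Pascal's rule gives
--   t_N(m,n) - t_{N-1}(m,n) - q^N t_{N-1}(m-1,n) + q^{2N-1} t_{N-2}(m-2,n) = h_N(m-3,n) - h_N(m,n-1)
-- for a companion term h_N.  After weighting by x^{m+3n} and summing, both shifts of h_N
-- contribute x³ Σ h_N and cancel, so F_N = (1 + x q^N) F_{N-1} - x² q^{2N-1} F_{N-2} with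
-- F_{-1} = 0; dividing by F_{N-1} gives the recursion defining R_N.  The exponents are
-- integer powers of q, which needs q ≠ 0; for q = 0 every F_N equals 1.
module Submission where

open import Defs
open import Data.Nat using (ℕ; _≤_; _<_; _∸_)
open import Data.Rational using (ℚ; 0ℚ; _*_)
open import Relation.Binary.PropositionalEquality using (_≡_; _≢_)

open import Algebra.Apartness.Properties.HeytingCommutativeRing using (x#0y#0→xy#0)
open import Algebra.Bundles using (CommutativeRing)
import Algebra.Properties.CommutativeSemiring.Exp as SemiringExp
open import Data.Empty using (⊥-elim)
open import Data.Integer as ℤ using (ℤ; +_; -[1+_]; 0ℤ; 1ℤ; _⊖_)
import Data.Integer.Properties as ℤ
import Data.Integer.Tactic.RingSolver as ℤ-Solver
open import Data.Nat as ℕ using (zero; suc; z≤n; s≤s; _≤?_)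
open import Data.Nat.DivMod using (m*n/n≡m)
import Data.Nat.Properties as ℕ
import Data.Nat.Tactic.RingSolver as ℕ-Solver
open import Data.Rational using (1ℚ; _+_; _-_; -_; ≢-nonZero)
open import Data.Rational.Properties
  using ( _≟_; +-*-commutativeRing; heytingCommutativeRing; 1≢0; *-inverseʳ; *-comm; *-assoc
        ; *-distribˡ-+; *-zeroˡ; *-zeroʳ; *-identityˡ; *-identityʳ; +-identityˡ; +-identityʳ)
open import Level using (0ℓ)
open import Relation.Binary.PropositionalEquality using (refl; sym; trans; cong; cong₂; subst; module ≡-Reasoning)
open import Relation.Nullary using (yes; no)
open import Relation.Nullary.Decidable using (dec⇒maybe)
open import Tactic.RingSolver using (solve-∀)
open import Tactic.RingSolver.Core.AlmostCommutativeRing using (AlmostCommutativeRing; fromCommutativeRing)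

ℚ-ring : AlmostCommutativeRing 0ℓ 0ℓ
ℚ-ring = fromCommutativeRing +-*-commutativeRing (λ p → dec⇒maybe (0ℚ ≟ p))

-- Powers and inverses in ℚ

private
  module Exp = SemiringExp (CommutativeRing.commutativeSemiring +-*-commutativeRing)

^≡Exp^ : ∀ p n → p ^ n ≡ p Exp.^ n
^≡Exp^ p zero    = refl
^≡Exp^ p (suc n) = cong (p *_) (^≡Exp^ p n)

^-+ : ∀ p m n → p ^ (m ℕ.+ n) ≡ p ^ m * p ^ n
^-+ p m n = begin
  p ^ (m ℕ.+ n)          ≡⟨ ^≡Exp^ p (m ℕ.+ n) ⟩
  p Exp.^ (m ℕ.+ n)      ≡⟨ Exp.^-homo-* p m n ⟩
  p Exp.^ m * p Exp.^ n  ≡⟨ sym (cong₂ _*_ (^≡Exp^ p m) (^≡Exp^ p n)) ⟩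
  p ^ m * p ^ n          ∎
  where open ≡-Reasoning

^-distrib-* : ∀ p r n → (p * r) ^ n ≡ p ^ n * r ^ n
^-distrib-* p r n = begin
  (p * r) ^ n            ≡⟨ ^≡Exp^ (p * r) n ⟩
  (p * r) Exp.^ n        ≡⟨ Exp.^-distrib-* p r n ⟩
  p Exp.^ n * r Exp.^ n  ≡⟨ sym (cong₂ _*_ (^≡Exp^ p n) (^≡Exp^ r n)) ⟩
  p ^ n * r ^ n          ∎
  where open ≡-Reasoning

1^n≡1 : ∀ n → 1ℚ ^ n ≡ 1ℚ
1^n≡1 zero    = refl
1^n≡1 (suc n) = trans (*-identityˡ _) (1^n≡1 n)

^-cube : ∀ p n → (p ^ 3) ^ n ≡ p ^ n * (p ^ n * p ^ n)
^-cube p n = begin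
  (p * (p * (p * 1ℚ))) ^ n            ≡⟨ ^-distrib-* p _ n ⟩
  p ^ n * (p * (p * 1ℚ)) ^ n          ≡⟨ cong (p ^ n *_) (^-distrib-* p _ n) ⟩
  p ^ n * (p ^ n * (p * 1ℚ) ^ n)      ≡⟨ cong (λ u → p ^ n * (p ^ n * u)) (^-distrib-* p 1ℚ n) ⟩
  p ^ n * (p ^ n * (p ^ n * 1ℚ ^ n))  ≡⟨ cong (λ u → p ^ n * (p ^ n * (p ^ n * u))) (1^n≡1 n) ⟩
  p ^ n * (p ^ n * (p ^ n * 1ℚ))      ≡⟨ cong (λ u → p ^ n * (p ^ n * u)) (*-identityʳ _) ⟩
  p ^ n * (p ^ n * p ^ n)             ∎
  where open ≡-Reasoning

*-invʳ : ∀ p → p ≢ 0ℚ → p * inv p ≡ 1ℚ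
*-invʳ p p≢0 with p ≟ 0ℚ
... | yes p≡0 = ⊥-elim (p≢0 p≡0)
... | no p≢0′ = *-inverseʳ p {{≢-nonZero p≢0′}}

*-≢0 : ∀ {p r} → p ≢ 0ℚ → r ≢ 0ℚ → p * r ≢ 0ℚ
*-≢0 = x#0y#0→xy#0 heytingCommutativeRing

inv-unique : ∀ {p r} → p * r ≡ 1ℚ → inv p ≡ r
inv-unique {p} {r} pr≡1 = begin
  inv p              ≡⟨ sym (*-identityʳ (inv p)) ⟩
  inv p * 1ℚ         ≡⟨ cong (inv p *_) (sym pr≡1) ⟩
  inv p * (p * r)    ≡⟨ reassoc (inv p) p r ⟩
  (p * inv p) * r    ≡⟨ cong (_* r) (*-invʳ p p≢0) ⟩
  1ℚ * r             ≡⟨ *-identityˡ r ⟩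
  r                  ∎
  where
  open ≡-Reasoning
  reassoc : ∀ a b c → a * (b * c) ≡ (b * a) * c
  reassoc = solve-∀ ℚ-ring
  p≢0 : p ≢ 0ℚ
  p≢0 p≡0 = 1≢0 (trans (sym pr≡1) (trans (cong (_* r) p≡0) (*-zeroˡ r)))

inv-^ : ∀ p n → p ≢ 0ℚ → inv (p ^ n) ≡ inv p ^ n
inv-^ p n p≢0 = inv-unique {p ^ n} (begin
  p ^ n * inv p ^ n  ≡⟨ sym (^-distrib-* p (inv p) n) ⟩
  (p * inv p) ^ n    ≡⟨ cong (_^ n) (*-invʳ p p≢0) ⟩
  1ℚ ^ n             ≡⟨ 1^n≡1 n ⟩
  1ℚ                 ∎)
  where open ≡-Reasoning

-- Integer powers

-- Since inv 0ℚ = 0ℚ, negative powers of 0ℚ are junk; the laws below assume p ≢ 0ℚ.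
infixr 8 _^ᶻ_
_^ᶻ_ : ℚ → ℤ → ℚ
p ^ᶻ + n      = p ^ n
p ^ᶻ -[1+ n ] = inv p ^ suc n

module _ {p : ℚ} (p≢0 : p ≢ 0ℚ) where

  ^ᶻ-⊖ : ∀ m n → p ^ᶻ (m ⊖ n) ≡ p ^ m * inv p ^ n
  ^ᶻ-⊖ m       zero    = sym (*-identityʳ _)
  ^ᶻ-⊖ zero    (suc n) = sym (*-identityˡ _)
  ^ᶻ-⊖ (suc m) (suc n) = begin
    p ^ᶻ (suc m ⊖ suc n)              ≡⟨ cong (p ^ᶻ_) (ℤ.[1+m]⊖[1+n]≡m⊖n m n) ⟩
    p ^ᶻ (m ⊖ n)                      ≡⟨ ^ᶻ-⊖ m n ⟩
    p ^ m * inv p ^ n                 ≡⟨ sym (*-identityʳ _) ⟩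
    p ^ m * inv p ^ n * 1ℚ            ≡⟨ cong (p ^ m * inv p ^ n *_) (sym (*-invʳ p p≢0)) ⟩
    p ^ m * inv p ^ n * (p * inv p)   ≡⟨ interchange (p ^ m) (inv p ^ n) p (inv p) ⟩
    (p * p ^ m) * (inv p * inv p ^ n) ∎
    where
    open ≡-Reasoning
    interchange : ∀ a b c d → a * b * (c * d) ≡ (c * a) * (d * b)
    interchange = solve-∀ ℚ-ring

  ^ᶻ-+ : ∀ i j → p ^ᶻ (i ℤ.+ j) ≡ p ^ᶻ i * p ^ᶻ j
  ^ᶻ-+ (+ m)    (+ n)    = ^-+ p m n
  ^ᶻ-+ (+ m)    -[1+ n ] = ^ᶻ-⊖ m (suc n)
  ^ᶻ-+ -[1+ m ] (+ n)    = trans (^ᶻ-⊖ n (suc m)) (*-comm (p ^ n) (inv p ^ suc m))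
  ^ᶻ-+ -[1+ m ] -[1+ n ] = trans (cong (λ u → inv p * (inv p * u)) (^-+ (inv p) m n)) (regroup (inv p) _ _)
    where
    regroup : ∀ a b c → a * (a * (b * c)) ≡ (a * b) * (a * c)
    regroup = solve-∀ ℚ-ring

  ^ᶻ-cube : ∀ k → (p ^ 3) ^ᶻ k ≡ p ^ᶻ k * (p ^ᶻ k * p ^ᶻ k)
  ^ᶻ-cube (+ n)    = ^-cube p n
  ^ᶻ-cube -[1+ n ] = trans (cong (_^ suc n) (inv-^ p 3 p≢0)) (^-cube (inv p) (suc n))

-- Gaussian binomial coefficients

-- Defined by q-Pascal's rule rather than as a quotient of q-factorials, so no division occurs.
qbinom : ℚ → ℕ → ℕ → ℚ
qbinom p a       zero    = 1ℚ
qbinom p zero    (suc b) = 0ℚ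
qbinom p (suc a) (suc b) = qbinom p a (suc b) + p ^ (a ∸ b) * qbinom p a b

qbinom-< : ∀ p {a b} → a < b → qbinom p a b ≡ 0ℚ
qbinom-< p {zero}  {suc b} _         = refl
qbinom-< p {suc a} {suc b} (s≤s a<b) =
  trans (cong₂ (λ u v → u + p ^ (a ∸ b) * v) (qbinom-< p (ℕ.m<n⇒m<1+n a<b)) (qbinom-< p a<b))
        (cong (_+_ 0ℚ) (*-zeroʳ (p ^ (a ∸ b))))

qbinom-diag : ∀ p a → qbinom p a a ≡ 1ℚ
qbinom-diag p zero = refl
qbinom-diag p (suc a) rewrite qbinom-< p (ℕ.n<1+n a) | ℕ.n∸n≡0 a | qbinom-diag p a = refl

qbinom-qfac : ∀ p b d → qbinom p (b ℕ.+ d) b * (qfac p b * qfac p d) ≡ qfac p (b ℕ.+ d)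
qbinom-qfac p zero    d = trans (*-identityˡ _) (*-identityˡ _)
qbinom-qfac p (suc b) zero rewrite ℕ.+-identityʳ b | qbinom-diag p (suc b) =
  trans (*-identityˡ _) (*-identityʳ _)
qbinom-qfac p (suc b) (suc d) = begin
  (A + p ^ (T ∸ b) * B) * (qfac p (suc b) * qfac p (suc d))
    ≡⟨ cong (λ e → (A + p ^ e * B) * (qfac p (suc b) * qfac p (suc d))) (ℕ.m+n∸m≡n b (suc d)) ⟩
  (A + pᵈ * B) * (qfac p (suc b) * qfac p (suc d))
    ≡⟨ expand A B (qfac p b) (qfac p d) pᵇ pᵈ ⟩
  A * (qfac p (suc b) * qfac p d) * (1ℚ - pᵈ) + pᵈ * (B * (qfac p b * qfac p (suc d))) * (1ℚ - pᵇ)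
    ≡⟨ cong₂ (λ u v → u * (1ℚ - pᵈ) + pᵈ * v * (1ℚ - pᵇ)) ih₁ ih₂ ⟩
  qfac p T * (1ℚ - pᵈ) + pᵈ * qfac p T * (1ℚ - pᵇ)
    ≡⟨ collect (qfac p T) pᵇ pᵈ ⟩
  qfac p T * (1ℚ - pᵇ * pᵈ)
    ≡⟨ cong (λ u → qfac p T * (1ℚ - u)) (sym (^-+ p (suc b) (suc d))) ⟩
  qfac p (suc T) ∎
  where
  open ≡-Reasoning
  T : ℕ
  T = b ℕ.+ suc d
  A B pᵇ pᵈ : ℚ
  A = qbinom p T (suc b)
  B = qbinom p T b
  pᵇ = p ^ suc b
  pᵈ = p ^ suc d
  ih₁ : A * (qfac p (suc b) * qfac p d) ≡ qfac p T
  ih₁ = subst (λ t → qbinom p t (suc b) * (qfac p (suc b) * qfac p d) ≡ qfac p t)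
              (sym (ℕ.+-suc b d)) (qbinom-qfac p (suc b) d)
  ih₂ : B * (qfac p b * qfac p (suc d)) ≡ qfac p T
  ih₂ = qbinom-qfac p b (suc d)
  expand : ∀ A B P D x y → (A + y * B) * ((P * (1ℚ - x)) * (D * (1ℚ - y)))
         ≡ A * ((P * (1ℚ - x)) * D) * (1ℚ - y) + y * (B * (P * (D * (1ℚ - y)))) * (1ℚ - x)
  expand = solve-∀ ℚ-ring
  collect : ∀ F x y → F * (1ℚ - y) + y * F * (1ℚ - x) ≡ F * (1ℚ - x * y)
  collect = solve-∀ ℚ-ring

gaussNat≡qbinom : ∀ {p} → (∀ n → qfac p n ≢ 0ℚ) → ∀ a b → gaussNat p a b ≡ qbinom p a b
gaussNat≡qbinom {p} qfac≢0 a b with b ≤? a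
... | no b≰a  = sym (qbinom-< p (ℕ.≰⇒> b≰a))
... | yes b≤a = begin
  qfac p a * inv D            ≡⟨ cong (_* inv D) (sym qfac-split) ⟩
  qbinom p a b * D * inv D    ≡⟨ *-assoc (qbinom p a b) D (inv D) ⟩
  qbinom p a b * (D * inv D)  ≡⟨ cong (qbinom p a b *_) (*-invʳ D (*-≢0 (qfac≢0 b) (qfac≢0 (a ∸ b)))) ⟩
  qbinom p a b * 1ℚ           ≡⟨ *-identityʳ _ ⟩
  qbinom p a b                ∎
  where
  open ≡-Reasoning
  D : ℚ
  D = qfac p b * qfac p (a ∸ b)
  qfac-split : qbinom p a b * D ≡ qfac p a
  qfac-split = subst (λ t → qbinom p t b * D ≡ qfac p t) (ℕ.m+[n∸m]≡n b≤a) (qbinom-qfac p b (a ∸ b))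

qbinomℤ : ℚ → ℤ → ℤ → ℚ
qbinomℤ p a       -[1+ _ ] = 0ℚ
qbinomℤ p -[1+ _ ] (+ b)   = 0ℚ
qbinomℤ p (+ a)   (+ b)    = qbinom p a b

gauss≡qbinomℤ : ∀ {p} → (∀ n → qfac p n ≢ 0ℚ) → ∀ a b → gauss p a b ≡ qbinomℤ p a b
gauss≡qbinomℤ qfac≢0 a        -[1+ _ ] = refl
gauss≡qbinomℤ qfac≢0 -[1+ _ ] (+ b)    = refl
gauss≡qbinomℤ qfac≢0 (+ a)    (+ b)    = gaussNat≡qbinom qfac≢0 a b

-- The coefficient only matters when 0 ≤ b ≤ a, so no assumption on p is needed.
qbinomℤ-pascal : ∀ p a b → a ≢ 0ℤ →
  qbinomℤ p a b ≡ qbinomℤ p (a ℤ.- 1ℤ) b + p ^ᶻ (a ℤ.- b) * qbinomℤ p (a ℤ.- 1ℤ) (b ℤ.- 1ℤ)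
qbinomℤ-pascal p a              b@(-[1+ _ ])  _   = sym (cong (_+_ 0ℚ) (*-zeroʳ (p ^ᶻ (a ℤ.- b))))
qbinomℤ-pascal p (+ zero)       (+ b)         a≢0 = ⊥-elim (a≢0 refl)
qbinomℤ-pascal p a@(-[1+ _ ])   b@(+ zero)    _   = sym (cong (_+_ 0ℚ) (*-zeroʳ (p ^ᶻ (a ℤ.- b))))
qbinomℤ-pascal p a@(-[1+ _ ])   b@(+ suc _)   _   = sym (cong (_+_ 0ℚ) (*-zeroʳ (p ^ᶻ (a ℤ.- b))))
qbinomℤ-pascal p a@(+ suc _)    b@(+ zero)    _   = sym (cong (_+_ 1ℚ) (*-zeroʳ (p ^ᶻ (a ℤ.- b))))
qbinomℤ-pascal p (+ suc t)      (+ suc k)     _   = cong (_+_ (qbinom p t (suc k))) coefficient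
  where
  coefficient : p ^ (t ∸ k) * qbinom p t k ≡ p ^ᶻ (suc t ⊖ suc k) * qbinom p t k
  coefficient with k ≤? t
  ... | yes k≤t = cong (λ i → p ^ᶻ i * qbinom p t k) (sym (trans (ℤ.[1+m]⊖[1+n]≡m⊖n t k) (ℤ.⊖-≥ k≤t)))
  ... | no k≰t rewrite qbinom-< p (ℕ.≰⇒> k≰t) =
    trans (*-zeroʳ (p ^ (t ∸ k))) (sym (*-zeroʳ (p ^ᶻ (suc t ⊖ suc k))))

qbinomℤ-negTop : ∀ p d b → qbinomℤ p -[1+ d ] b ≡ 0ℚ
qbinomℤ-negTop p d -[1+ _ ] = refl
qbinomℤ-negTop p d (+ _)    = refl

qbinomℤ-zeroTop : ∀ p b → b ≢ 0ℤ → qbinomℤ p 0ℤ b ≡ 0ℚ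
qbinomℤ-zeroTop p -[1+ _ ]  _   = refl
qbinomℤ-zeroTop p (+ zero)  b≢0 = ⊥-elim (b≢0 refl)
qbinomℤ-zeroTop p (+ suc _) _   = refl

qbinomℤ-predTop : ∀ p b → qbinomℤ p (b ℤ.- 1ℤ) b ≡ 0ℚ
qbinomℤ-predTop p (+ zero)  = refl
qbinomℤ-predTop p (+ suc b) = qbinom-< p (ℕ.n<1+n b)
qbinomℤ-predTop p -[1+ _ ]  = refl

-- A top index -(1 + u + c v) with u, c, v natural is negative; this is the shape the ℤ ring
-- solver reaches in the support lemmas for the summand.
qbinomℤ-vanish : ∀ p {a} u c v b → a ≡ ℤ.- (1ℤ ℤ.+ (+ u ℤ.+ + c ℤ.* + v)) → qbinomℤ p a b ≡ 0ℚ
qbinomℤ-vanish p u c v b refl rewrite sym (ℤ.pos-* c v) = qbinomℤ-negTop p (u ℕ.+ c ℕ.* v) b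

qbinomℤ-pascal³ : ∀ p a m → a ≢ 0ℤ →
  let x₀ = p ^ᶻ (a ℤ.- m) ; x₁ = p ^ᶻ (a ℤ.- (m ℤ.- 1ℤ)) ; x₂ = p ^ᶻ (a ℤ.- (m ℤ.- 1ℤ ℤ.- 1ℤ)) in
  qbinomℤ p a m - x₀ * qbinomℤ p a (m ℤ.- 1ℤ) + x₀ * (x₁ * qbinomℤ p a (m ℤ.- 1ℤ ℤ.- 1ℤ))
  ≡ qbinomℤ p (a ℤ.- 1ℤ) m + x₀ * (x₁ * (x₂ * qbinomℤ p (a ℤ.- 1ℤ) (m ℤ.- 1ℤ ℤ.- 1ℤ ℤ.- 1ℤ)))
qbinomℤ-pascal³ p a m a≢0 =
  telescope (G m) (G (m ℤ.- 1ℤ)) (G (m ℤ.- 1ℤ ℤ.- 1ℤ)) (G (m ℤ.- 1ℤ ℤ.- 1ℤ ℤ.- 1ℤ))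
            (p ^ᶻ (a ℤ.- m)) (p ^ᶻ (a ℤ.- (m ℤ.- 1ℤ))) (p ^ᶻ (a ℤ.- (m ℤ.- 1ℤ ℤ.- 1ℤ)))
            (pascal m) (pascal (m ℤ.- 1ℤ)) (pascal (m ℤ.- 1ℤ ℤ.- 1ℤ))
  where
  G : ℤ → ℚ
  G = qbinomℤ p (a ℤ.- 1ℤ)
  pascal : ∀ b → qbinomℤ p a b ≡ G b + p ^ᶻ (a ℤ.- b) * G (b ℤ.- 1ℤ)
  pascal b = qbinomℤ-pascal p a b a≢0
  telescope : ∀ {A₀ A₁ A₂} B₀ B₁ B₂ B₃ x₀ x₁ x₂ →
    A₀ ≡ B₀ + x₀ * B₁ → A₁ ≡ B₁ + x₁ * B₂ → A₂ ≡ B₂ + x₂ * B₃ →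
    A₀ - x₀ * A₁ + x₀ * (x₁ * A₂) ≡ B₀ + x₀ * (x₁ * (x₂ * B₃))
  telescope B₀ B₁ B₂ B₃ x₀ x₁ x₂ refl refl refl = cancel B₀ B₁ B₂ B₃ x₀ x₁ x₂
    where
    cancel : ∀ B₀ B₁ B₂ B₃ x₀ x₁ x₂ →
      B₀ + x₀ * B₁ - x₀ * (B₁ + x₁ * B₂) + x₀ * (x₁ * (B₂ + x₂ * B₃)) ≡ B₀ + x₀ * (x₁ * (x₂ * B₃))
    cancel = solve-∀ ℚ-ring

-- Pascal's rule for [a, ·]_p fails only at a = 0 and for [c, ·]_r only at c = 0; the
-- hypotheses of pascal-four-term make the affected products vanish there.
module PascalFourTerm (p r : ℚ) (a c m n : ℤ) where

  A₀ A₁ A₂ B₀ B₃ H₀ H₁ H₂ x₀ x₁ x₂ y : ℚ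
  A₀ = qbinomℤ p a m
  A₁ = qbinomℤ p a (m ℤ.- 1ℤ)
  A₂ = qbinomℤ p a (m ℤ.- 1ℤ ℤ.- 1ℤ)
  B₀ = qbinomℤ p (a ℤ.- 1ℤ) m
  B₃ = qbinomℤ p (a ℤ.- 1ℤ) (m ℤ.- 1ℤ ℤ.- 1ℤ ℤ.- 1ℤ)
  H₀ = qbinomℤ r c n
  H₁ = qbinomℤ r (c ℤ.- 1ℤ) n
  H₂ = qbinomℤ r (c ℤ.- 1ℤ) (n ℤ.- 1ℤ)
  x₀ = p ^ᶻ (a ℤ.- m)
  x₁ = p ^ᶻ (a ℤ.- (m ℤ.- 1ℤ))
  x₂ = p ^ᶻ (a ℤ.- (m ℤ.- 1ℤ ℤ.- 1ℤ))
  y  = r ^ᶻ (c ℤ.- n)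

  first-column : (a ≡ 0ℤ → H₀ ≡ 0ℚ) →
    (A₀ - x₀ * A₁ + x₀ * (x₁ * A₂)) * H₀ ≡ (B₀ + x₀ * (x₁ * (x₂ * B₃))) * H₀
  first-column hₐ with a ℤ.≟ 0ℤ
  ... | yes a≡0 rewrite hₐ a≡0 =
    trans (*-zeroʳ (A₀ - x₀ * A₁ + x₀ * (x₁ * A₂))) (sym (*-zeroʳ (B₀ + x₀ * (x₁ * (x₂ * B₃)))))
  ... | no a≢0 = cong (_* H₀) (qbinomℤ-pascal³ p a m a≢0)

  last-column : (c ≡ 0ℤ → B₀ ≡ 0ℚ) → B₀ * (H₀ - H₁) ≡ y * (B₀ * H₂)
  last-column h꜀ with c ℤ.≟ 0ℤ
  ... | yes c≡0 rewrite h꜀ c≡0 = trans (*-zeroˡ (H₀ - H₁)) (sym (trans (cong (y *_) (*-zeroˡ H₂)) (*-zeroʳ y)))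
  ... | no c≢0 = trans (cong (λ u → B₀ * (u - H₁)) (qbinomℤ-pascal r c n c≢0)) (cancel B₀ H₁ y H₂)
    where
    cancel : ∀ B H₁ y H₂ → B * (H₁ + y * H₂ - H₁) ≡ y * (B * H₂)
    cancel = solve-∀ ℚ-ring

  pascal-four-term : (a ≡ 0ℤ → H₀ ≡ 0ℚ) → (c ≡ 0ℤ → B₀ ≡ 0ℚ) →
    A₀ * H₀ - B₀ * H₁ - x₀ * (A₁ * H₀) + x₀ * (x₁ * (A₂ * H₀))
    ≡ x₀ * (x₁ * (x₂ * (B₃ * H₀))) + y * (B₀ * H₂)
  pascal-four-term hₐ h꜀ = begin
    A₀ * H₀ - B₀ * H₁ - x₀ * (A₁ * H₀) + x₀ * (x₁ * (A₂ * H₀))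
      ≡⟨ regroup A₀ A₁ A₂ B₀ H₀ H₁ x₀ x₁ ⟩
    (A₀ - x₀ * A₁ + x₀ * (x₁ * A₂)) * H₀ - B₀ * H₁
      ≡⟨ cong (λ u → u - B₀ * H₁) (first-column hₐ) ⟩
    (B₀ + x₀ * (x₁ * (x₂ * B₃))) * H₀ - B₀ * H₁
      ≡⟨ separate B₀ B₃ H₀ H₁ x₀ x₁ x₂ ⟩
    x₀ * (x₁ * (x₂ * (B₃ * H₀))) + B₀ * (H₀ - H₁)
      ≡⟨ cong (_+_ (x₀ * (x₁ * (x₂ * (B₃ * H₀))))) (last-column h꜀) ⟩
    x₀ * (x₁ * (x₂ * (B₃ * H₀))) + y * (B₀ * H₂) ∎
    where
    open ≡-Reasoning
    regroup : ∀ A₀ A₁ A₂ B₀ H₀ H₁ x₀ x₁ →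
      A₀ * H₀ - B₀ * H₁ - x₀ * (A₁ * H₀) + x₀ * (x₁ * (A₂ * H₀))
      ≡ (A₀ - x₀ * A₁ + x₀ * (x₁ * A₂)) * H₀ - B₀ * H₁
    regroup = solve-∀ ℚ-ring
    separate : ∀ B₀ B₃ H₀ H₁ x₀ x₁ x₂ →
      (B₀ + x₀ * (x₁ * (x₂ * B₃))) * H₀ - B₀ * H₁ ≡ x₀ * (x₁ * (x₂ * (B₃ * H₀))) + B₀ * (H₀ - H₁)
    separate = solve-∀ ℚ-ring

-- The summand and its four-term recurrence

sgn : ℤ → ℚ
sgn (+ n)    = (- 1ℚ) ^ n
sgn -[1+ n ] = (- 1ℚ) ^ suc n

sgn-pred : ∀ n → sgn (n ℤ.- 1ℤ) ≡ - sgn n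
sgn-pred (+ zero)  = refl
sgn-pred (+ suc n) = flip ((- 1ℚ) ^ n)
  where
  flip : ∀ s → s ≡ - (- 1ℚ * s)
  flip = solve-∀ ℚ-ring
sgn-pred -[1+ n ] rewrite ℕ.+-identityʳ n = negate (sgn -[1+ n ])
  where
  negate : ∀ s → - 1ℚ * s ≡ - s
  negate = solve-∀ ℚ-ring

triℕ : ℕ → ℕ
triℕ zero    = 0
triℕ (suc n) = triℕ n ℕ.+ suc n

-- n(n+1)/2, extended by tri (-1 - n) = tri n so that tri (n - 1) ≡ tri n - n on all of ℤ.
tri : ℤ → ℤ
tri (+ n)    = + triℕ n
tri -[1+ n ] = + triℕ n

tri-pred : ∀ n → tri (n ℤ.- 1ℤ) ≡ tri n ℤ.- n
tri-pred (+ zero)  = refl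
tri-pred (+ suc n) = trans (add-sub (+ triℕ n) (+ n)) (cong (ℤ._- + suc n) (sym (ℤ.pos-+ (triℕ n) (suc n))))
  where
  add-sub : ∀ t n → t ≡ t ℤ.+ (1ℤ ℤ.+ n) ℤ.- (1ℤ ℤ.+ n)
  add-sub = ℤ-Solver.solve-∀
tri-pred -[1+ n ] rewrite ℕ.+-identityʳ n = ℤ.pos-+ (triℕ n) (suc n)

-- The paper's exponent binom(3n+1, 2) + m² + 3mn, using binom(3n+1, 2) = 3n² + 3 tri n.
exponent : ℤ → ℤ → ℤ
exponent m n = + 3 ℤ.* n ℤ.* n ℤ.+ + 3 ℤ.* tri n ℤ.+ m ℤ.* m ℤ.+ + 3 ℤ.* m ℤ.* n

topₘ topₙ : ℤ → ℤ → ℤ → ℤ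
topₘ N m n = N ℤ.- + 3 ℤ.* n ℤ.- m ℤ.+ 1ℤ
topₙ N m n = N ℤ.- + 2 ℤ.* n ℤ.- m

module _ (q : ℚ) where

  gaussTerm : ℤ → ℤ → ℤ → ℤ → ℤ → ℚ
  gaussTerm e a c m n = sgn n * (q ^ᶻ e * (qbinomℤ q a m * qbinomℤ (q ^ 3) c n))

  -- The paper's summand of F_N without its factor x^{m+3n}, at arbitrary integer indices.
  summand : ℤ → ℤ → ℤ → ℚ
  summand N m n = gaussTerm (exponent m n) (topₘ N m n) (topₙ N m n) m n

  -- Its shifts m ↦ m - 3 and n ↦ n - 1 have the same generating sum up to the factor x³
  -- (genSum-companion-shiftₘ and genSum-companion-shiftₙ), which makes summand-recurrence telescope.
  companion : ℤ → ℤ → ℤ → ℚ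
  companion N m n =
    gaussTerm (exponent m n ℤ.+ + 3 ℤ.* N ℤ.- + 3) (N ℤ.- + 3 ℤ.* n ℤ.- m ℤ.- + 3) (N ℤ.- + 2 ℤ.* n ℤ.- m ℤ.- + 3) m n

  summand-at-N-1 : ∀ N m n →
    summand (N ℤ.- 1ℤ) m n ≡ gaussTerm (exponent m n) (topₘ N m n ℤ.- 1ℤ) (topₙ N m n ℤ.- 1ℤ) m n
  summand-at-N-1 N m n = cong₂ (λ a c → gaussTerm (exponent m n) a c m n) (top₁ N m n) (top₂ N m n)
    where
    top₁ : ∀ N m n → N ℤ.- 1ℤ ℤ.- + 3 ℤ.* n ℤ.- m ℤ.+ 1ℤ ≡ N ℤ.- + 3 ℤ.* n ℤ.- m ℤ.+ 1ℤ ℤ.- 1ℤ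
    top₁ = ℤ-Solver.solve-∀
    top₂ : ∀ N m n → N ℤ.- 1ℤ ℤ.- + 2 ℤ.* n ℤ.- m ≡ N ℤ.- + 2 ℤ.* n ℤ.- m ℤ.- 1ℤ
    top₂ = ℤ-Solver.solve-∀

  topₘ≡0⇒qbinomℤ≡0 : ∀ N m n → topₘ N m n ≡ 0ℤ → qbinomℤ (q ^ 3) (topₙ N m n) n ≡ 0ℚ
  topₘ≡0⇒qbinomℤ≡0 N m n a≡0 = trans (cong (λ c → qbinomℤ (q ^ 3) c n) c≡n-1) (qbinomℤ-predTop (q ^ 3) n)
    where
    shift : ∀ N m n → N ℤ.- + 2 ℤ.* n ℤ.- m ≡ N ℤ.- + 3 ℤ.* n ℤ.- m ℤ.+ 1ℤ ℤ.+ n ℤ.- 1ℤ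
    shift = ℤ-Solver.solve-∀
    c≡n-1 : topₙ N m n ≡ n ℤ.- 1ℤ
    c≡n-1 = trans (shift N m n) (trans (cong (λ a → a ℤ.+ n ℤ.- 1ℤ) a≡0) (cong (ℤ._- 1ℤ) (ℤ.+-identityˡ n)))

  topₙ≡0⇒qbinomℤ≡0 : ∀ N m n → N ≢ 0ℤ → topₙ N m (+ n) ≡ 0ℤ → qbinomℤ q (topₘ N m (+ n) ℤ.- 1ℤ) m ≡ 0ℚ
  topₙ≡0⇒qbinomℤ≡0 N m n N≢0 c≡0 =
    trans (cong (λ a → qbinomℤ q a m) (trans (shift N m (+ n)) (cong (ℤ._- + n) c≡0))) (vanishes n c≡0)
    where
    shift : ∀ N m n → N ℤ.- + 3 ℤ.* n ℤ.- m ℤ.+ 1ℤ ℤ.- 1ℤ ≡ N ℤ.- + 2 ℤ.* n ℤ.- m ℤ.- n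
    shift = ℤ-Solver.solve-∀
    recover : ∀ N m n → N ≡ N ℤ.- + 2 ℤ.* n ℤ.- m ℤ.+ + 2 ℤ.* n ℤ.+ m
    recover = ℤ-Solver.solve-∀
    vanishes : ∀ j → topₙ N m (+ j) ≡ 0ℤ → qbinomℤ q (0ℤ ℤ.- + j) m ≡ 0ℚ
    vanishes (suc j) _   = qbinomℤ-negTop q j m
    vanishes zero    c≡0 = subst (λ b → qbinomℤ q 0ℤ b ≡ 0ℚ) N≡m (qbinomℤ-zeroTop q N N≢0)
      where
      N≡m : N ≡ m
      N≡m = trans (recover N m (+ 0)) (trans (cong (λ c → c ℤ.+ + 2 ℤ.* + 0 ℤ.+ m) c≡0) (ℤ.+-identityˡ m))

module _ {q : ℚ} (q≢0 : q ≢ 0ℚ) where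

  gaussTerm-+ : ∀ d e a c m n → gaussTerm q (d ℤ.+ e) a c m n ≡ q ^ᶻ d * gaussTerm q e a c m n
  gaussTerm-+ d e a c m n =
    trans (cong (λ u → sgn n * (u * P)) (^ᶻ-+ q≢0 d e)) (swap (sgn n) (q ^ᶻ d) (q ^ᶻ e) P)
    where
    P : ℚ
    P = qbinomℤ q a m * qbinomℤ (q ^ 3) c n
    swap : ∀ s x y P → s * (x * y * P) ≡ x * (s * (y * P))
    swap = solve-∀ ℚ-ring

  gaussTerm-reindex : ∀ {e e′ a a′ c c′} d m n → e ≡ d ℤ.+ e′ → a ≡ a′ → c ≡ c′ →
    gaussTerm q e a c m n ≡ q ^ᶻ d * gaussTerm q e′ a′ c′ m n
  gaussTerm-reindex d m n refl refl refl = gaussTerm-+ d _ _ _ m n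

  gaussTerm-four-term : ∀ e a c m n →
    (a ≡ 0ℤ → qbinomℤ (q ^ 3) c n ≡ 0ℚ) → (c ≡ 0ℤ → qbinomℤ q (a ℤ.- 1ℤ) m ≡ 0ℚ) →
    let T = gaussTerm q e
        d₀ = a ℤ.- m ; d₁ = a ℤ.- (m ℤ.- 1ℤ) ; d₂ = a ℤ.- (m ℤ.- 1ℤ ℤ.- 1ℤ) ; k = c ℤ.- n in
    T a c m n - T (a ℤ.- 1ℤ) (c ℤ.- 1ℤ) m n
      - q ^ᶻ d₀ * T a c (m ℤ.- 1ℤ) n + q ^ᶻ (d₀ ℤ.+ d₁) * T a c (m ℤ.- 1ℤ ℤ.- 1ℤ) n
    ≡ q ^ᶻ (d₀ ℤ.+ d₁ ℤ.+ d₂) * T (a ℤ.- 1ℤ) c (m ℤ.- 1ℤ ℤ.- 1ℤ ℤ.- 1ℤ) n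
      - q ^ᶻ (k ℤ.+ (k ℤ.+ k)) * T (a ℤ.- 1ℤ) (c ℤ.- 1ℤ) m (n ℤ.- 1ℤ)
  gaussTerm-four-term e a c m n hₐ h꜀ = begin
    w (A₀ * H₀) - w (B₀ * H₁) - x₀ * w (A₁ * H₀) + q ^ᶻ (d₀ ℤ.+ d₁) * w (A₂ * H₀)
      ≡⟨ cong (λ u → w (A₀ * H₀) - w (B₀ * H₁) - x₀ * w (A₁ * H₀) + u * w (A₂ * H₀)) (^ᶻ-+ q≢0 d₀ d₁) ⟩
    w (A₀ * H₀) - w (B₀ * H₁) - x₀ * w (A₁ * H₀) + x₀ * x₁ * w (A₂ * H₀)
      ≡⟨ factor s ζ x₀ x₁ (A₀ * H₀) (B₀ * H₁) (A₁ * H₀) (A₂ * H₀) ⟩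
    w (A₀ * H₀ - B₀ * H₁ - x₀ * (A₁ * H₀) + x₀ * (x₁ * (A₂ * H₀)))
      ≡⟨ cong w (pascal-four-term hₐ h꜀) ⟩
    w (x₀ * (x₁ * (x₂ * (B₃ * H₀))) + y * (B₀ * H₂))
      ≡⟨ unfactor s ζ x₀ x₁ x₂ y (B₃ * H₀) (B₀ * H₂) ⟩
    x₀ * x₁ * x₂ * w (B₃ * H₀) - y * (- s * (ζ * (B₀ * H₂)))
      ≡⟨ cong₂ (λ u v → u * w (B₃ * H₀) - v * (- s * (ζ * (B₀ * H₂)))) (sym split₃) (sym cube) ⟩
    q ^ᶻ (d₀ ℤ.+ d₁ ℤ.+ d₂) * w (B₃ * H₀) - q ^ᶻ (k ℤ.+ (k ℤ.+ k)) * (- s * (ζ * (B₀ * H₂)))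
      ≡⟨ cong (λ u → q ^ᶻ (d₀ ℤ.+ d₁ ℤ.+ d₂) * w (B₃ * H₀) - q ^ᶻ (k ℤ.+ (k ℤ.+ k)) * (u * (ζ * (B₀ * H₂))))
              (sym (sgn-pred n)) ⟩
    q ^ᶻ (d₀ ℤ.+ d₁ ℤ.+ d₂) * w (B₃ * H₀) - q ^ᶻ (k ℤ.+ (k ℤ.+ k)) * (sgn (n ℤ.- 1ℤ) * (ζ * (B₀ * H₂))) ∎
    where
    open ≡-Reasoning
    open PascalFourTerm q (q ^ 3) a c m n
    d₀ d₁ d₂ k : ℤ
    d₀ = a ℤ.- m
    d₁ = a ℤ.- (m ℤ.- 1ℤ)
    d₂ = a ℤ.- (m ℤ.- 1ℤ ℤ.- 1ℤ)
    k  = c ℤ.- n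
    s ζ : ℚ
    s = sgn n
    ζ = q ^ᶻ e
    w : ℚ → ℚ
    w u = s * (ζ * u)
    split₃ : q ^ᶻ (d₀ ℤ.+ d₁ ℤ.+ d₂) ≡ x₀ * x₁ * x₂
    split₃ = trans (^ᶻ-+ q≢0 (d₀ ℤ.+ d₁) d₂) (cong (_* x₂) (^ᶻ-+ q≢0 d₀ d₁))
    cube : q ^ᶻ (k ℤ.+ (k ℤ.+ k)) ≡ y
    cube = trans (^ᶻ-+ q≢0 k (k ℤ.+ k)) (trans (cong (q ^ᶻ k *_) (^ᶻ-+ q≢0 k k)) (sym (^ᶻ-cube q≢0 k)))
    factor : ∀ s ζ x₀ x₁ P₀ P₁ P₂ P₃ →
      s * (ζ * P₀) - s * (ζ * P₁) - x₀ * (s * (ζ * P₂)) + x₀ * x₁ * (s * (ζ * P₃))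
      ≡ s * (ζ * (P₀ - P₁ - x₀ * P₂ + x₀ * (x₁ * P₃)))
    factor = solve-∀ ℚ-ring
    unfactor : ∀ s ζ x₀ x₁ x₂ y P₄ P₅ →
      s * (ζ * (x₀ * (x₁ * (x₂ * P₄)) + y * P₅)) ≡ x₀ * x₁ * x₂ * (s * (ζ * P₄)) - y * (- s * (ζ * P₅))
    unfactor = solve-∀ ℚ-ring

  gaussTerm-shift : ∀ {e e′ a a′ c c′} d d′ m n → d ℤ.+ e ≡ d′ ℤ.+ e′ → a ≡ a′ → c ≡ c′ →
    q ^ᶻ d * gaussTerm q e a c m n ≡ q ^ᶻ d′ * gaussTerm q e′ a′ c′ m n
  gaussTerm-shift {e} {a = a} {c = c} d d′ m n eq refl refl =
    trans (sym (gaussTerm-+ d e a c m n)) (gaussTerm-reindex d′ m n eq refl refl)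

  summand-at-N-1-m-1 : ∀ N m n → let a = topₘ N m n in
    q ^ᶻ N * summand q (N ℤ.- 1ℤ) (m ℤ.- 1ℤ) n
    ≡ q ^ᶻ (a ℤ.- m) * gaussTerm q (exponent m n) a (topₙ N m n) (m ℤ.- 1ℤ) n
  summand-at-N-1-m-1 N m n =
    gaussTerm-shift N (topₘ N m n ℤ.- m) (m ℤ.- 1ℤ) n (expo N m n (tri n)) (top₁ N m n) (top₂ N m n)
    where
    expo : ∀ N m n t →
      N ℤ.+ (+ 3 ℤ.* n ℤ.* n ℤ.+ + 3 ℤ.* t ℤ.+ (m ℤ.- 1ℤ) ℤ.* (m ℤ.- 1ℤ) ℤ.+ + 3 ℤ.* (m ℤ.- 1ℤ) ℤ.* n)
      ≡ (N ℤ.- + 3 ℤ.* n ℤ.- m ℤ.+ 1ℤ ℤ.- m)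
        ℤ.+ (+ 3 ℤ.* n ℤ.* n ℤ.+ + 3 ℤ.* t ℤ.+ m ℤ.* m ℤ.+ + 3 ℤ.* m ℤ.* n)
    expo = ℤ-Solver.solve-∀
    top₁ : ∀ N m n → N ℤ.- 1ℤ ℤ.- + 3 ℤ.* n ℤ.- (m ℤ.- 1ℤ) ℤ.+ 1ℤ ≡ N ℤ.- + 3 ℤ.* n ℤ.- m ℤ.+ 1ℤ
    top₁ = ℤ-Solver.solve-∀
    top₂ : ∀ N m n → N ℤ.- 1ℤ ℤ.- + 2 ℤ.* n ℤ.- (m ℤ.- 1ℤ) ≡ N ℤ.- + 2 ℤ.* n ℤ.- m
    top₂ = ℤ-Solver.solve-∀

  summand-at-N-2-m-2 : ∀ N m n → let a = topₘ N m n in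
    q ^ᶻ (N ℤ.+ N ℤ.- 1ℤ) * summand q (N ℤ.- 1ℤ ℤ.- 1ℤ) (m ℤ.- 1ℤ ℤ.- 1ℤ) n
    ≡ q ^ᶻ (a ℤ.- m ℤ.+ (a ℤ.- (m ℤ.- 1ℤ))) * gaussTerm q (exponent m n) a (topₙ N m n) (m ℤ.- 1ℤ ℤ.- 1ℤ) n
  summand-at-N-2-m-2 N m n =
    gaussTerm-shift (N ℤ.+ N ℤ.- 1ℤ) (d₀ ℤ.+ d₁) (m ℤ.- 1ℤ ℤ.- 1ℤ) n (expo N m n (tri n)) (top₁ N m n) (top₂ N m n)
    where
    d₀ d₁ : ℤ
    d₀ = topₘ N m n ℤ.- m
    d₁ = topₘ N m n ℤ.- (m ℤ.- 1ℤ)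
    expo : ∀ N m n t →
      N ℤ.+ N ℤ.- 1ℤ ℤ.+ (+ 3 ℤ.* n ℤ.* n ℤ.+ + 3 ℤ.* t ℤ.+ (m ℤ.- 1ℤ ℤ.- 1ℤ) ℤ.* (m ℤ.- 1ℤ ℤ.- 1ℤ)
                          ℤ.+ + 3 ℤ.* (m ℤ.- 1ℤ ℤ.- 1ℤ) ℤ.* n)
      ≡ (N ℤ.- + 3 ℤ.* n ℤ.- m ℤ.+ 1ℤ ℤ.- m ℤ.+ (N ℤ.- + 3 ℤ.* n ℤ.- m ℤ.+ 1ℤ ℤ.- (m ℤ.- 1ℤ)))
        ℤ.+ (+ 3 ℤ.* n ℤ.* n ℤ.+ + 3 ℤ.* t ℤ.+ m ℤ.* m ℤ.+ + 3 ℤ.* m ℤ.* n)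
    expo = ℤ-Solver.solve-∀
    top₁ : ∀ N m n →
      N ℤ.- 1ℤ ℤ.- 1ℤ ℤ.- + 3 ℤ.* n ℤ.- (m ℤ.- 1ℤ ℤ.- 1ℤ) ℤ.+ 1ℤ ≡ N ℤ.- + 3 ℤ.* n ℤ.- m ℤ.+ 1ℤ
    top₁ = ℤ-Solver.solve-∀
    top₂ : ∀ N m n → N ℤ.- 1ℤ ℤ.- 1ℤ ℤ.- + 2 ℤ.* n ℤ.- (m ℤ.- 1ℤ ℤ.- 1ℤ) ≡ N ℤ.- + 2 ℤ.* n ℤ.- m
    top₂ = ℤ-Solver.solve-∀

  companion-at-m-3 : ∀ N m n → let a = topₘ N m n in
    companion q N (m ℤ.- 1ℤ ℤ.- 1ℤ ℤ.- 1ℤ) n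
    ≡ q ^ᶻ (a ℤ.- m ℤ.+ (a ℤ.- (m ℤ.- 1ℤ)) ℤ.+ (a ℤ.- (m ℤ.- 1ℤ ℤ.- 1ℤ)))
      * gaussTerm q (exponent m n) (a ℤ.- 1ℤ) (topₙ N m n) (m ℤ.- 1ℤ ℤ.- 1ℤ ℤ.- 1ℤ) n
  companion-at-m-3 N m n =
    gaussTerm-reindex (d₀ ℤ.+ d₁ ℤ.+ d₂) (m ℤ.- 1ℤ ℤ.- 1ℤ ℤ.- 1ℤ) n (expo N m n (tri n)) (top₁ N m n) (top₂ N m n)
    where
    d₀ d₁ d₂ : ℤ
    d₀ = topₘ N m n ℤ.- m
    d₁ = topₘ N m n ℤ.- (m ℤ.- 1ℤ)
    d₂ = topₘ N m n ℤ.- (m ℤ.- 1ℤ ℤ.- 1ℤ)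
    expo : ∀ N m n t →
      + 3 ℤ.* n ℤ.* n ℤ.+ + 3 ℤ.* t ℤ.+ (m ℤ.- 1ℤ ℤ.- 1ℤ ℤ.- 1ℤ) ℤ.* (m ℤ.- 1ℤ ℤ.- 1ℤ ℤ.- 1ℤ)
        ℤ.+ + 3 ℤ.* (m ℤ.- 1ℤ ℤ.- 1ℤ ℤ.- 1ℤ) ℤ.* n ℤ.+ + 3 ℤ.* N ℤ.- + 3
      ≡ (N ℤ.- + 3 ℤ.* n ℤ.- m ℤ.+ 1ℤ ℤ.- m ℤ.+ (N ℤ.- + 3 ℤ.* n ℤ.- m ℤ.+ 1ℤ ℤ.- (m ℤ.- 1ℤ))
          ℤ.+ (N ℤ.- + 3 ℤ.* n ℤ.- m ℤ.+ 1ℤ ℤ.- (m ℤ.- 1ℤ ℤ.- 1ℤ)))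
        ℤ.+ (+ 3 ℤ.* n ℤ.* n ℤ.+ + 3 ℤ.* t ℤ.+ m ℤ.* m ℤ.+ + 3 ℤ.* m ℤ.* n)
    expo = ℤ-Solver.solve-∀
    top₁ : ∀ N m n →
      N ℤ.- + 3 ℤ.* n ℤ.- (m ℤ.- 1ℤ ℤ.- 1ℤ ℤ.- 1ℤ) ℤ.- + 3 ≡ N ℤ.- + 3 ℤ.* n ℤ.- m ℤ.+ 1ℤ ℤ.- 1ℤ
    top₁ = ℤ-Solver.solve-∀
    top₂ : ∀ N m n → N ℤ.- + 2 ℤ.* n ℤ.- (m ℤ.- 1ℤ ℤ.- 1ℤ ℤ.- 1ℤ) ℤ.- + 3 ≡ N ℤ.- + 2 ℤ.* n ℤ.- m
    top₂ = ℤ-Solver.solve-∀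

  companion-at-n-1 : ∀ N m n → let k = topₙ N m n ℤ.- n in
    companion q N m (n ℤ.- 1ℤ)
    ≡ q ^ᶻ (k ℤ.+ (k ℤ.+ k)) * gaussTerm q (exponent m n) (topₘ N m n ℤ.- 1ℤ) (topₙ N m n ℤ.- 1ℤ) m (n ℤ.- 1ℤ)
  companion-at-n-1 N m n =
    gaussTerm-reindex (k ℤ.+ (k ℤ.+ k)) m (n ℤ.- 1ℤ) (expo N m n (tri n) (tri-pred n)) (top₁ N m n) (top₂ N m n)
    where
    k : ℤ
    k = topₙ N m n ℤ.- n
    expo : ∀ N m n t {t′} → t′ ≡ t ℤ.- n →
      + 3 ℤ.* (n ℤ.- 1ℤ) ℤ.* (n ℤ.- 1ℤ) ℤ.+ + 3 ℤ.* t′ ℤ.+ m ℤ.* m ℤ.+ + 3 ℤ.* m ℤ.* (n ℤ.- 1ℤ)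
        ℤ.+ + 3 ℤ.* N ℤ.- + 3
      ≡ (N ℤ.- + 2 ℤ.* n ℤ.- m ℤ.- n ℤ.+ (N ℤ.- + 2 ℤ.* n ℤ.- m ℤ.- n ℤ.+ (N ℤ.- + 2 ℤ.* n ℤ.- m ℤ.- n)))
        ℤ.+ (+ 3 ℤ.* n ℤ.* n ℤ.+ + 3 ℤ.* t ℤ.+ m ℤ.* m ℤ.+ + 3 ℤ.* m ℤ.* n)
    expo N m n t refl = polynomial N m n t
      where
      polynomial : ∀ N m n t →
        + 3 ℤ.* (n ℤ.- 1ℤ) ℤ.* (n ℤ.- 1ℤ) ℤ.+ + 3 ℤ.* (t ℤ.- n) ℤ.+ m ℤ.* m ℤ.+ + 3 ℤ.* m ℤ.* (n ℤ.- 1ℤ)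
          ℤ.+ + 3 ℤ.* N ℤ.- + 3
        ≡ (N ℤ.- + 2 ℤ.* n ℤ.- m ℤ.- n ℤ.+ (N ℤ.- + 2 ℤ.* n ℤ.- m ℤ.- n ℤ.+ (N ℤ.- + 2 ℤ.* n ℤ.- m ℤ.- n)))
          ℤ.+ (+ 3 ℤ.* n ℤ.* n ℤ.+ + 3 ℤ.* t ℤ.+ m ℤ.* m ℤ.+ + 3 ℤ.* m ℤ.* n)
      polynomial = ℤ-Solver.solve-∀
    top₁ : ∀ N m n → N ℤ.- + 3 ℤ.* (n ℤ.- 1ℤ) ℤ.- m ℤ.- + 3 ≡ N ℤ.- + 3 ℤ.* n ℤ.- m ℤ.+ 1ℤ ℤ.- 1ℤ
    top₁ = ℤ-Solver.solve-∀
    top₂ : ∀ N m n → N ℤ.- + 2 ℤ.* (n ℤ.- 1ℤ) ℤ.- m ℤ.- + 3 ≡ N ℤ.- + 2 ℤ.* n ℤ.- m ℤ.- 1ℤ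
    top₂ = ℤ-Solver.solve-∀

  summand-recurrence : ∀ N m n → N ≢ 0ℤ →
    summand q N m (+ n) - summand q (N ℤ.- 1ℤ) m (+ n)
      - q ^ᶻ N * summand q (N ℤ.- 1ℤ) (m ℤ.- 1ℤ) (+ n)
      + q ^ᶻ (N ℤ.+ N ℤ.- 1ℤ) * summand q (N ℤ.- 1ℤ ℤ.- 1ℤ) (m ℤ.- 1ℤ ℤ.- 1ℤ) (+ n)
    ≡ companion q N (m ℤ.- 1ℤ ℤ.- 1ℤ ℤ.- 1ℤ) (+ n) - companion q N m (+ n ℤ.- 1ℤ)
  summand-recurrence N m n N≢0 = begin
    summand q N m n′ - summand q (N ℤ.- 1ℤ) m n′
      - q ^ᶻ N * summand q (N ℤ.- 1ℤ) (m ℤ.- 1ℤ) n′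
      + q ^ᶻ (N ℤ.+ N ℤ.- 1ℤ) * summand q (N ℤ.- 1ℤ ℤ.- 1ℤ) (m ℤ.- 1ℤ ℤ.- 1ℤ) n′
      ≡⟨ neighbours (summand q N m n′)
                    (summand-at-N-1 q N m n′) (summand-at-N-1-m-1 N m n′) (summand-at-N-2-m-2 N m n′) ⟩
    T a c m n′ - T (a ℤ.- 1ℤ) (c ℤ.- 1ℤ) m n′
      - q ^ᶻ (a ℤ.- m) * T a c (m ℤ.- 1ℤ) n′
      + q ^ᶻ (a ℤ.- m ℤ.+ (a ℤ.- (m ℤ.- 1ℤ))) * T a c (m ℤ.- 1ℤ ℤ.- 1ℤ) n′
      ≡⟨ gaussTerm-four-term (exponent m n′) a c m n′
                             (topₘ≡0⇒qbinomℤ≡0 q N m n′) (topₙ≡0⇒qbinomℤ≡0 q N m n N≢0) ⟩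
    q ^ᶻ (a ℤ.- m ℤ.+ (a ℤ.- (m ℤ.- 1ℤ)) ℤ.+ (a ℤ.- (m ℤ.- 1ℤ ℤ.- 1ℤ)))
        * T (a ℤ.- 1ℤ) c (m ℤ.- 1ℤ ℤ.- 1ℤ ℤ.- 1ℤ) n′
      - q ^ᶻ (c ℤ.- n′ ℤ.+ (c ℤ.- n′ ℤ.+ (c ℤ.- n′))) * T (a ℤ.- 1ℤ) (c ℤ.- 1ℤ) m (n′ ℤ.- 1ℤ)
      ≡⟨ sym (cong₂ _-_ (companion-at-m-3 N m n′) (companion-at-n-1 N m n′)) ⟩
    companion q N (m ℤ.- 1ℤ ℤ.- 1ℤ ℤ.- 1ℤ) n′ - companion q N m (n′ ℤ.- 1ℤ) ∎
    where
    open ≡-Reasoning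
    n′ a c : ℤ
    n′ = + n
    a = topₘ N m n′
    c = topₙ N m n′
    T : ℤ → ℤ → ℤ → ℤ → ℚ
    T = gaussTerm q (exponent m n′)
    neighbours : ∀ t {u u′ v v′ w w′} → u ≡ u′ → v ≡ v′ → w ≡ w′ → t - u - v + w ≡ t - u′ - v′ + w′
    neighbours t refl refl refl = refl

-- Finite sums and truncated generating sums

sumTo-cong : ∀ {f g} → (∀ i → f i ≡ g i) → ∀ k → sumTo k f ≡ sumTo k g
sumTo-cong f≗g zero    = f≗g 0
sumTo-cong f≗g (suc k) = cong₂ _+_ (sumTo-cong f≗g k) (f≗g (suc k))

sumTo-zero : ∀ {f} → (∀ i → f i ≡ 0ℚ) → ∀ k → sumTo k f ≡ 0ℚ
sumTo-zero f≗0 zero    = f≗0 0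
sumTo-zero f≗0 (suc k) = cong₂ _+_ (sumTo-zero f≗0 k) (f≗0 (suc k))

sumTo-+ : ∀ k f g → sumTo k (λ i → f i + g i) ≡ sumTo k f + sumTo k g
sumTo-+ zero    f g = refl
sumTo-+ (suc k) f g =
  trans (cong (_+ (f (suc k) + g (suc k))) (sumTo-+ k f g)) (interchange (sumTo k f) (sumTo k g) (f (suc k)) (g (suc k)))
  where
  interchange : ∀ a b c d → a + b + (c + d) ≡ a + c + (b + d)
  interchange = solve-∀ ℚ-ring

sumTo-- : ∀ k f g → sumTo k (λ i → f i - g i) ≡ sumTo k f - sumTo k g
sumTo-- zero    f g = refl
sumTo-- (suc k) f g =
  trans (cong (_+ (f (suc k) - g (suc k))) (sumTo-- k f g)) (interchange (sumTo k f) (sumTo k g) (f (suc k)) (g (suc k)))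
  where
  interchange : ∀ a b c d → a - b + (c - d) ≡ a + c - (b + d)
  interchange = solve-∀ ℚ-ring

sumTo-* : ∀ k c f → sumTo k (λ i → c * f i) ≡ c * sumTo k f
sumTo-* zero    c f = refl
sumTo-* (suc k) c f = trans (cong (_+ c * f (suc k)) (sumTo-* k c f)) (sym (*-distribˡ-+ c (sumTo k f) (f (suc k))))

sumTo-head : ∀ {f} → (∀ i → f (suc i) ≡ 0ℚ) → ∀ k → sumTo k f ≡ f 0
sumTo-head f≗0 zero    = refl
sumTo-head f≗0 (suc k) = trans (cong₂ _+_ (sumTo-head f≗0 k) (f≗0 k)) (+-identityʳ _)

sumTo-tail : ∀ {f} → f 0 ≡ 0ℚ → ∀ k → sumTo (suc k) f ≡ sumTo k (λ i → f (suc i))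
sumTo-tail {f} f0≡0 zero    = trans (cong (_+ f 1) f0≡0) (+-identityˡ (f 1))
sumTo-tail {f} f0≡0 (suc k) = cong (_+ f (suc (suc k))) (sumTo-tail f0≡0 k)

sumTo-extend : ∀ {f} k → (∀ j → f (suc j ℕ.+ k) ≡ 0ℚ) → ∀ d → sumTo (d ℕ.+ k) f ≡ sumTo k f
sumTo-extend k f≗0 zero    = refl
sumTo-extend k f≗0 (suc d) = trans (cong₂ _+_ (sumTo-extend k f≗0 d) (f≗0 d)) (+-identityʳ _)

module _ (x : ℚ) where

  genSum : ℕ → ℕ → (ℤ → ℤ → ℚ) → ℚ
  genSum K L f = sumTo K (λ m → sumTo L (λ n → x ^ (m ℕ.+ 3 ℕ.* n) * f (+ m) (+ n)))

  weighted-zero : ∀ m n {v} → v ≡ 0ℚ → x ^ (m ℕ.+ 3 ℕ.* n) * v ≡ 0ℚ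
  weighted-zero m n refl = *-zeroʳ (x ^ (m ℕ.+ 3 ℕ.* n))

  genSum-cong : ∀ f g K L → (∀ m n → f (+ m) (+ n) ≡ g (+ m) (+ n)) → genSum K L f ≡ genSum K L g
  genSum-cong f g K L f≗g = sumTo-cong (λ m → sumTo-cong (λ n → cong (x ^ (m ℕ.+ 3 ℕ.* n) *_) (f≗g m n)) L) K

  genSum-+ : ∀ K L f g → genSum K L (λ m n → f m n + g m n) ≡ genSum K L f + genSum K L g
  genSum-+ K L f g = trans
    (sumTo-cong (λ m → trans (sumTo-cong (λ n → *-distribˡ-+ (x ^ (m ℕ.+ 3 ℕ.* n)) _ _) L) (sumTo-+ L _ _)) K)
    (sumTo-+ K _ _)

  genSum-- : ∀ K L f g → genSum K L (λ m n → f m n - g m n) ≡ genSum K L f - genSum K L g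
  genSum-- K L f g = trans
    (sumTo-cong (λ m → trans (sumTo-cong (λ n → distrib (x ^ (m ℕ.+ 3 ℕ.* n)) _ _) L) (sumTo-- L _ _)) K)
    (sumTo-- K _ _)
    where
    distrib : ∀ c a b → c * (a - b) ≡ c * a - c * b
    distrib = solve-∀ ℚ-ring

  genSum-* : ∀ K L c f → genSum K L (λ m n → c * f m n) ≡ c * genSum K L f
  genSum-* K L c f = trans
    (sumTo-cong (λ m → trans (sumTo-cong (λ n → swap (x ^ (m ℕ.+ 3 ℕ.* n)) c _) L) (sumTo-* L c _)) K)
    (sumTo-* K c _)
    where
    swap : ∀ a c b → a * (c * b) ≡ c * (a * b)
    swap = solve-∀ ℚ-ring

  genSum-shiftₘ : ∀ f K L → (∀ k n → f -[1+ k ] n ≡ 0ℚ) →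
    genSum (suc K) L (λ m n → f (m ℤ.- 1ℤ) n) ≡ x * genSum K L f
  genSum-shiftₘ f K L f≗0 = begin
    genSum (suc K) L (λ m n → f (m ℤ.- 1ℤ) n)
      ≡⟨ sumTo-tail (sumTo-zero (λ n → weighted-zero 0 n (f≗0 0 (+ n))) L) K ⟩
    sumTo K (λ m → sumTo L (λ n → x * x ^ (m ℕ.+ 3 ℕ.* n) * f (+ m) (+ n)))
      ≡⟨ sumTo-cong (λ m → trans (sumTo-cong (λ n → *-assoc x (x ^ (m ℕ.+ 3 ℕ.* n)) (f (+ m) (+ n))) L) (sumTo-* L x _)) K ⟩
    sumTo K (λ m → x * sumTo L (λ n → x ^ (m ℕ.+ 3 ℕ.* n) * f (+ m) (+ n)))
      ≡⟨ sumTo-* K x _ ⟩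
    x * genSum K L f ∎
    where open ≡-Reasoning

  genSum-shiftₙ : ∀ f K L → (∀ m k → f m -[1+ k ] ≡ 0ℚ) →
    genSum K (suc L) (λ m n → f m (n ℤ.- 1ℤ)) ≡ x ^ 3 * genSum K L f
  genSum-shiftₙ f K L f≗0 = begin
    genSum K (suc L) (λ m n → f m (n ℤ.- 1ℤ))
      ≡⟨ sumTo-cong (λ m → sumTo-tail (weighted-zero m 0 (f≗0 (+ m) 0)) L) K ⟩
    sumTo K (λ m → sumTo L (λ n → x ^ (m ℕ.+ 3 ℕ.* suc n) * f (+ m) (+ n)))
      ≡⟨ sumTo-cong (λ m → trans (sumTo-cong (λ n → step m n) L) (sumTo-* L (x ^ 3) _)) K ⟩
    sumTo K (λ m → x ^ 3 * sumTo L (λ n → x ^ (m ℕ.+ 3 ℕ.* n) * f (+ m) (+ n)))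
      ≡⟨ sumTo-* K (x ^ 3) _ ⟩
    x ^ 3 * genSum K L f ∎
    where
    open ≡-Reasoning
    step : ∀ m n → x ^ (m ℕ.+ 3 ℕ.* suc n) * f (+ m) (+ n) ≡ x ^ 3 * (x ^ (m ℕ.+ 3 ℕ.* n) * f (+ m) (+ n))
    step m n = trans (cong (λ e → x ^ e * f (+ m) (+ n)) (exponent-shift m n))
                     (trans (cong (_* f (+ m) (+ n)) (^-+ x 3 (m ℕ.+ 3 ℕ.* n)))
                            (*-assoc (x ^ 3) (x ^ (m ℕ.+ 3 ℕ.* n)) (f (+ m) (+ n))))
      where
      exponent-shift : ∀ m n → m ℕ.+ 3 ℕ.* suc n ≡ 3 ℕ.+ (m ℕ.+ 3 ℕ.* n)
      exponent-shift = ℕ-Solver.solve-∀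

  genSum-support : ∀ f K L → (∀ j n → f (+ (suc j ℕ.+ K)) (+ n) ≡ 0ℚ) → (∀ m j → f (+ m) (+ (suc j ℕ.+ L)) ≡ 0ℚ) →
    ∀ d e → genSum (d ℕ.+ K) (e ℕ.+ L) f ≡ genSum K L f
  genSum-support f K L f≗0ₘ f≗0ₙ d e = begin
    sumTo (d ℕ.+ K) (λ m → sumTo (e ℕ.+ L) (λ n → x ^ (m ℕ.+ 3 ℕ.* n) * f (+ m) (+ n)))
      ≡⟨ sumTo-cong (λ m → sumTo-extend L (λ j → weighted-zero m (suc j ℕ.+ L) (f≗0ₙ m j)) e) (d ℕ.+ K) ⟩
    sumTo (d ℕ.+ K) (λ m → sumTo L (λ n → x ^ (m ℕ.+ 3 ℕ.* n) * f (+ m) (+ n)))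
      ≡⟨ sumTo-extend K (λ j → sumTo-zero (λ n → weighted-zero (suc j ℕ.+ K) n (f≗0ₘ j n)) L) d ⟩
    genSum K L f ∎
    where open ≡-Reasoning

  genSum-zero : ∀ f K L → (∀ m n → f (+ m) (+ n) ≡ 0ℚ) → genSum K L f ≡ 0ℚ
  genSum-zero f K L f≗0 = sumTo-zero (λ m → sumTo-zero (λ n → weighted-zero m n (f≗0 m n)) L) K

  genSum-linear : ∀ K L α β f g h k →
    genSum K L (λ m n → f m n - g m n - α * h m n + β * k m n)
    ≡ genSum K L f - genSum K L g - α * genSum K L h + β * genSum K L k
  genSum-linear K L α β f g h k =
    trans (genSum-+ K L (λ m n → f m n - g m n - α * h m n) (λ m n → β * k m n))
          (cong₂ _+_ (trans (genSum-- K L (λ m n → f m n - g m n) (λ m n → α * h m n))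
                            (cong₂ _-_ (genSum-- K L f g) (genSum-* K L α h)))
                     (genSum-* K L β k))

-- Vanishing of the summand outside a box

module _ (q : ℚ) where

  gaussTerm-vanishₘ : ∀ e a c m n → qbinomℤ q a m ≡ 0ℚ → gaussTerm q e a c m n ≡ 0ℚ
  gaussTerm-vanishₘ e a c m n G≡0 rewrite G≡0 =
    trans (cong (λ u → sgn n * (q ^ᶻ e * u)) (*-zeroˡ (qbinomℤ (q ^ 3) c n)))
          (trans (cong (sgn n *_) (*-zeroʳ (q ^ᶻ e))) (*-zeroʳ (sgn n)))

  gaussTerm-vanishₙ : ∀ e a c m n → qbinomℤ (q ^ 3) c n ≡ 0ℚ → gaussTerm q e a c m n ≡ 0ℚ
  gaussTerm-vanishₙ e a c m n H≡0 rewrite H≡0 =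
    trans (cong (λ u → sgn n * (q ^ᶻ e * u)) (*-zeroʳ (qbinomℤ q a m)))
          (trans (cong (sgn n *_) (*-zeroʳ (q ^ᶻ e))) (*-zeroʳ (sgn n)))

  summand-vanishₘ : ∀ N m n → qbinomℤ q (topₘ N m n) m ≡ 0ℚ → summand q N m n ≡ 0ℚ
  summand-vanishₘ N m n = gaussTerm-vanishₘ (exponent m n) (topₘ N m n) (topₙ N m n) m n

  summand-vanishₙ : ∀ N m n → qbinomℤ (q ^ 3) (topₙ N m n) n ≡ 0ℚ → summand q N m n ≡ 0ℚ
  summand-vanishₙ N m n = gaussTerm-vanishₙ (exponent m n) (topₘ N m n) (topₙ N m n) m n

  companion-vanishₘ : ∀ N m n → qbinomℤ q (N ℤ.- + 3 ℤ.* n ℤ.- m ℤ.- + 3) m ≡ 0ℚ → companion q N m n ≡ 0ℚ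
  companion-vanishₘ N m n =
    gaussTerm-vanishₘ (exponent m n ℤ.+ + 3 ℤ.* N ℤ.- + 3)
      (N ℤ.- + 3 ℤ.* n ℤ.- m ℤ.- + 3) (N ℤ.- + 2 ℤ.* n ℤ.- m ℤ.- + 3) m n

  companion-vanishₙ : ∀ N m n → qbinomℤ (q ^ 3) (N ℤ.- + 2 ℤ.* n ℤ.- m ℤ.- + 3) n ≡ 0ℚ → companion q N m n ≡ 0ℚ
  companion-vanishₙ N m n =
    gaussTerm-vanishₙ (exponent m n ℤ.+ + 3 ℤ.* N ℤ.- + 3)
      (N ℤ.- + 3 ℤ.* n ℤ.- m ℤ.- + 3) (N ℤ.- + 2 ℤ.* n ℤ.- m ℤ.- + 3) m n

  summand-negₘ : ∀ N k n → summand q N -[1+ k ] n ≡ 0ℚ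
  summand-negₘ N k n = summand-vanishₘ N -[1+ k ] n refl

  companion-negₘ : ∀ N k n → companion q N -[1+ k ] n ≡ 0ℚ
  companion-negₘ N k n = companion-vanishₘ N -[1+ k ] n refl

  companion-negₙ : ∀ N m k → companion q N m -[1+ k ] ≡ 0ℚ
  companion-negₙ N m k = companion-vanishₙ N m -[1+ k ] refl

  summand-supportₘ : ∀ N j n → summand q (+ N) (+ (suc j ℕ.+ suc N)) (+ n) ≡ 0ℚ
  summand-supportₘ N j n =
    summand-vanishₘ (+ N) (+ (suc j ℕ.+ suc N)) (+ n)
      (qbinomℤ-vanish q j 3 n (+ (suc j ℕ.+ suc N)) (top (+ N) (+ n) (+ j)))
    where
    top : ∀ N n j → N ℤ.- + 3 ℤ.* n ℤ.- (1ℤ ℤ.+ j ℤ.+ (1ℤ ℤ.+ N)) ℤ.+ 1ℤ ≡ ℤ.- (1ℤ ℤ.+ (j ℤ.+ + 3 ℤ.* n))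
    top = ℤ-Solver.solve-∀

  summand-supportₙ : ∀ N m j → summand q (+ N) (+ m) (+ (suc j ℕ.+ N)) ≡ 0ℚ
  summand-supportₙ N m j =
    summand-vanishₙ (+ N) (+ m) (+ (suc j ℕ.+ N))
      (qbinomℤ-vanish (q ^ 3) (suc (N ℕ.+ m)) 2 j (+ (suc j ℕ.+ N)) (top (+ N) (+ m) (+ j)))
    where
    top : ∀ N m j → N ℤ.- + 2 ℤ.* (1ℤ ℤ.+ j ℤ.+ N) ℤ.- m ≡ ℤ.- (1ℤ ℤ.+ (1ℤ ℤ.+ N ℤ.+ m ℤ.+ + 2 ℤ.* j))
    top = ℤ-Solver.solve-∀

  companion-supportₘ : ∀ N j n → companion q (+ N) (+ (suc j ℕ.+ N)) (+ n) ≡ 0ℚ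
  companion-supportₘ N j n =
    companion-vanishₘ (+ N) (+ (suc j ℕ.+ N)) (+ n)
      (qbinomℤ-vanish q (3 ℕ.+ j) 3 n (+ (suc j ℕ.+ N)) (top (+ N) (+ n) (+ j)))
    where
    top : ∀ N n j → N ℤ.- + 3 ℤ.* n ℤ.- (1ℤ ℤ.+ j ℤ.+ N) ℤ.- + 3 ≡ ℤ.- (1ℤ ℤ.+ (+ 3 ℤ.+ j ℤ.+ + 3 ℤ.* n))
    top = ℤ-Solver.solve-∀

  companion-supportₙ : ∀ N m j → companion q (+ N) (+ m) (+ (suc j ℕ.+ N)) ≡ 0ℚ
  companion-supportₙ N m j =
    companion-vanishₙ (+ N) (+ m) (+ (suc j ℕ.+ N))
      (qbinomℤ-vanish (q ^ 3) (4 ℕ.+ N ℕ.+ m) 2 j (+ (suc j ℕ.+ N)) (top (+ N) (+ m) (+ j)))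
    where
    top : ∀ N m j →
      N ℤ.- + 2 ℤ.* (1ℤ ℤ.+ j ℤ.+ N) ℤ.- m ℤ.- + 3 ≡ ℤ.- (1ℤ ℤ.+ (+ 4 ℤ.+ N ℤ.+ m ℤ.+ + 2 ℤ.* j))
    top = ℤ-Solver.solve-∀

  summand-at-minus-one : ∀ m n → summand q (ℤ.- 1ℤ) (+ m) (+ n) ≡ 0ℚ
  summand-at-minus-one m n =
    summand-vanishₙ (ℤ.- 1ℤ) (+ m) (+ n)
      (qbinomℤ-vanish (q ^ 3) m 2 n (+ n) (top (+ m) (+ n)))
    where
    top : ∀ m n → ℤ.- 1ℤ ℤ.- + 2 ℤ.* n ℤ.- m ≡ ℤ.- (1ℤ ℤ.+ (m ℤ.+ + 2 ℤ.* n))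
    top = ℤ-Solver.solve-∀

-- The three-term recurrence for F

triℕ-double : ∀ n → triℕ n ℕ.* 2 ≡ n ℕ.* suc n
triℕ-double zero    = refl
triℕ-double (suc n) = begin
  (triℕ n ℕ.+ suc n) ℕ.* 2      ≡⟨ ℕ.*-distribʳ-+ 2 (triℕ n) (suc n) ⟩
  triℕ n ℕ.* 2 ℕ.+ suc n ℕ.* 2  ≡⟨ cong (ℕ._+ suc n ℕ.* 2) (triℕ-double n) ⟩
  n ℕ.* suc n ℕ.+ suc n ℕ.* 2   ≡⟨ expand n ⟩
  suc n ℕ.* suc (suc n)         ∎
  where
  open ≡-Reasoning
  expand : ∀ n → n ℕ.* suc n ℕ.+ suc n ℕ.* 2 ≡ suc n ℕ.* suc (suc n)
  expand = ℕ-Solver.solve-∀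

binom2-3n+1 : ∀ n → binom2 (3 ℕ.* n ℕ.+ 1) ≡ 3 ℕ.* n ℕ.* n ℕ.+ 3 ℕ.* triℕ n
binom2-3n+1 n = begin
  ((3 ℕ.* n ℕ.+ 1) ℕ.* (3 ℕ.* n ℕ.+ 1 ∸ 1)) ℕ./ 2
    ≡⟨ cong (λ t → ((3 ℕ.* n ℕ.+ 1) ℕ.* t) ℕ./ 2) (ℕ.m+n∸n≡m (3 ℕ.* n) 1) ⟩
  ((3 ℕ.* n ℕ.+ 1) ℕ.* (3 ℕ.* n)) ℕ./ 2
    ≡⟨ cong (ℕ._/ 2) doubled ⟩
  ((3 ℕ.* n ℕ.* n ℕ.+ 3 ℕ.* triℕ n) ℕ.* 2) ℕ./ 2
    ≡⟨ m*n/n≡m (3 ℕ.* n ℕ.* n ℕ.+ 3 ℕ.* triℕ n) 2 ⟩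
  3 ℕ.* n ℕ.* n ℕ.+ 3 ℕ.* triℕ n ∎
  where
  open ≡-Reasoning
  expand : ∀ n t → (3 ℕ.* n ℕ.* n ℕ.+ 3 ℕ.* t) ℕ.* 2 ≡ 6 ℕ.* n ℕ.* n ℕ.+ 3 ℕ.* (t ℕ.* 2)
  expand = ℕ-Solver.solve-∀
  factor : ∀ n → 6 ℕ.* n ℕ.* n ℕ.+ 3 ℕ.* (n ℕ.* suc n) ≡ (3 ℕ.* n ℕ.+ 1) ℕ.* (3 ℕ.* n)
  factor = ℕ-Solver.solve-∀
  doubled : (3 ℕ.* n ℕ.+ 1) ℕ.* (3 ℕ.* n) ≡ (3 ℕ.* n ℕ.* n ℕ.+ 3 ℕ.* triℕ n) ℕ.* 2
  doubled = sym (trans (expand n (triℕ n)) (trans (cong (λ t → 6 ℕ.* n ℕ.* n ℕ.+ 3 ℕ.* t) (triℕ-double n)) (factor n)))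

exponent-pos : ∀ m n → + (binom2 (3 ℕ.* n ℕ.+ 1) ℕ.+ m ℕ.* m ℕ.+ 3 ℕ.* m ℕ.* n) ≡ exponent (+ m) (+ n)
exponent-pos m n = begin
  + (binom2 (3 ℕ.* n ℕ.+ 1) ℕ.+ m ℕ.* m ℕ.+ 3 ℕ.* m ℕ.* n)
    ≡⟨ cong (λ b → + (b ℕ.+ m ℕ.* m ℕ.+ 3 ℕ.* m ℕ.* n)) (binom2-3n+1 n) ⟩
  + (3 ℕ.* n ℕ.* n) ℤ.+ + (3 ℕ.* triℕ n) ℤ.+ + (m ℕ.* m) ℤ.+ + (3 ℕ.* m ℕ.* n)
    ≡⟨ cong₂ ℤ._+_ (cong₂ ℤ._+_ (cong₂ ℤ._+_ (pos-*² 3 n n) (ℤ.pos-* 3 (triℕ n))) (ℤ.pos-* m m)) (pos-*² 3 m n) ⟩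
  exponent (+ m) (+ n) ∎
  where
  open ≡-Reasoning
  pos-*² : ∀ a b c → + (a ℕ.* b ℕ.* c) ≡ + a ℤ.* + b ℤ.* + c
  pos-*² a b c = trans (ℤ.pos-* (a ℕ.* b) c) (cong (ℤ._* + c) (ℤ.pos-* a b))

Fpred : ℚ → ℚ → ℕ → ℚ
Fpred x q zero    = 0ℚ
Fpred x q (suc M) = F x q M

module _ (x : ℚ) {q : ℚ} (q≢0 : q ≢ 0ℚ) where

  genSum-four-term : ∀ N → N ≢ 0ℤ → ∀ K L →
    genSum x K L (summand q N) - genSum x K L (summand q (N ℤ.- 1ℤ))
      - q ^ᶻ N * genSum x K L (λ m n → summand q (N ℤ.- 1ℤ) (m ℤ.- 1ℤ) n)
      + q ^ᶻ (N ℤ.+ N ℤ.- 1ℤ) * genSum x K L (λ m n → summand q (N ℤ.- 1ℤ ℤ.- 1ℤ) (m ℤ.- 1ℤ ℤ.- 1ℤ) n)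
    ≡ genSum x K L (λ m n → companion q N (m ℤ.- 1ℤ ℤ.- 1ℤ ℤ.- 1ℤ) n)
      - genSum x K L (λ m n → companion q N m (n ℤ.- 1ℤ))
  genSum-four-term N N≢0 K L = begin
    Σ (summand q N) - Σ (summand q (N ℤ.- 1ℤ)) - q ^ᶻ N * Σ S₁ + q ^ᶻ (N ℤ.+ N ℤ.- 1ℤ) * Σ S₂
      ≡⟨ sym (genSum-linear x K L (q ^ᶻ N) (q ^ᶻ (N ℤ.+ N ℤ.- 1ℤ)) (summand q N) (summand q (N ℤ.- 1ℤ)) S₁ S₂) ⟩
    Σ (λ m n → summand q N m n - summand q (N ℤ.- 1ℤ) m n - q ^ᶻ N * S₁ m n + q ^ᶻ (N ℤ.+ N ℤ.- 1ℤ) * S₂ m n)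
      ≡⟨ genSum-cong x (λ m n → summand q N m n - summand q (N ℤ.- 1ℤ) m n
                                 - q ^ᶻ N * S₁ m n + q ^ᶻ (N ℤ.+ N ℤ.- 1ℤ) * S₂ m n)
                     (λ m n → H₁ m n - H₂ m n) K L (λ m n → summand-recurrence q≢0 N (+ m) n N≢0) ⟩
    Σ (λ m n → H₁ m n - H₂ m n)
      ≡⟨ genSum-- x K L H₁ H₂ ⟩
    Σ H₁ - Σ H₂ ∎
    where
    open ≡-Reasoning
    Σ = genSum x K L
    S₁ S₂ H₁ H₂ : ℤ → ℤ → ℚ
    S₁ m n = summand q (N ℤ.- 1ℤ) (m ℤ.- 1ℤ) n
    S₂ m n = summand q (N ℤ.- 1ℤ ℤ.- 1ℤ) (m ℤ.- 1ℤ ℤ.- 1ℤ) n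
    H₁ m n = companion q N (m ℤ.- 1ℤ ℤ.- 1ℤ ℤ.- 1ℤ) n
    H₂ m n = companion q N m (n ℤ.- 1ℤ)

companionSum : ℚ → ℚ → ℕ → ℚ
companionSum x q M = genSum x (suc M) (suc M) (companion q (+ suc M))

module _ (x q : ℚ) where

  companionSum-support : ∀ M d e →
    genSum x (d ℕ.+ suc M) (e ℕ.+ suc M) (companion q (+ suc M)) ≡ companionSum x q M
  companionSum-support M = genSum-support x (companion q (+ suc M)) (suc M) (suc M)
                             (companion-supportₘ q (suc M)) (companion-supportₙ q (suc M))

  genSum-companion-shiftₘ : ∀ M →
    genSum x (4 ℕ.+ M) (4 ℕ.+ M) (λ m n → companion q (+ suc M) (m ℤ.- 1ℤ ℤ.- 1ℤ ℤ.- 1ℤ) n)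
    ≡ x * (x * (x * companionSum x q M))
  genSum-companion-shiftₘ M = begin
    genSum x B B (λ m n → f (m ℤ.- 1ℤ ℤ.- 1ℤ ℤ.- 1ℤ) n)
      ≡⟨ genSum-shiftₘ x (λ m n → f (m ℤ.- 1ℤ ℤ.- 1ℤ) n) (3 ℕ.+ M) B (λ k → companion-negₘ q N _) ⟩
    x * genSum x (3 ℕ.+ M) B (λ m n → f (m ℤ.- 1ℤ ℤ.- 1ℤ) n)
      ≡⟨ cong (x *_) (genSum-shiftₘ x (λ m n → f (m ℤ.- 1ℤ) n) (2 ℕ.+ M) B (λ k → companion-negₘ q N _)) ⟩
    x * (x * genSum x (2 ℕ.+ M) B (λ m n → f (m ℤ.- 1ℤ) n))
      ≡⟨ cong (λ u → x * (x * u)) (genSum-shiftₘ x f (1 ℕ.+ M) B (companion-negₘ q N)) ⟩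
    x * (x * (x * genSum x (1 ℕ.+ M) B f))
      ≡⟨ cong (λ u → x * (x * (x * u))) (companionSum-support M 0 3) ⟩
    x * (x * (x * companionSum x q M)) ∎
    where
    open ≡-Reasoning
    N : ℤ
    B : ℕ
    f : ℤ → ℤ → ℚ
    N = + suc M
    B = 4 ℕ.+ M
    f = companion q N

  genSum-companion-shiftₙ : ∀ M →
    genSum x (4 ℕ.+ M) (4 ℕ.+ M) (λ m n → companion q (+ suc M) m (n ℤ.- 1ℤ)) ≡ x ^ 3 * companionSum x q M
  genSum-companion-shiftₙ M =
    trans (genSum-shiftₙ x (companion q (+ suc M)) (4 ℕ.+ M) (3 ℕ.+ M) (companion-negₙ q (+ suc M)))
          (cong (x ^ 3 *_) (companionSum-support M 3 2))

module _ (x : ℚ) {q : ℚ} (qfac≢0 : ∀ n → qfac q n ≢ 0ℚ) (qfac³≢0 : ∀ n → qfac (q ^ 3) n ≢ 0ℚ) where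

  term≡summand : ∀ N m n → term x q N m n ≡ x ^ (m ℕ.+ 3 ℕ.* n) * summand q (+ N) (+ m) (+ n)
  term≡summand N m n = begin
    ((- 1ℚ) ^ n * q ^ᶻ + e) * x ^ k * gauss q A (+ m) * gauss (q ^ 3) C (+ n)
      ≡⟨ cong (λ e′ → ((- 1ℚ) ^ n * q ^ᶻ e′) * x ^ k * gauss q A (+ m) * gauss (q ^ 3) C (+ n)) (exponent-pos m n) ⟩
    ((- 1ℚ) ^ n * ζ) * x ^ k * gauss q A (+ m) * gauss (q ^ 3) C (+ n)
      ≡⟨ cong₂ (λ u v → ((- 1ℚ) ^ n * ζ) * x ^ k * u * v) G≡ H≡ ⟩
    ((- 1ℚ) ^ n * ζ) * x ^ k * G * H
      ≡⟨ regroup ((- 1ℚ) ^ n) ζ (x ^ k) G H ⟩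
    x ^ k * ((- 1ℚ) ^ n * (ζ * (G * H))) ∎
    where
    open ≡-Reasoning
    e k : ℕ
    ζ G H : ℚ
    A C : ℤ
    e = binom2 (3 ℕ.* n ℕ.+ 1) ℕ.+ m ℕ.* m ℕ.+ 3 ℕ.* m ℕ.* n
    k = m ℕ.+ 3 ℕ.* n
    ζ = q ^ᶻ exponent (+ m) (+ n)
    A = + N ℤ.- + (3 ℕ.* n) ℤ.- + m ℤ.+ + 1
    C = + N ℤ.- + (2 ℕ.* n) ℤ.- + m
    G = qbinomℤ q (+ N ℤ.- + 3 ℤ.* + n ℤ.- + m ℤ.+ 1ℤ) (+ m)
    H = qbinomℤ (q ^ 3) (+ N ℤ.- + 2 ℤ.* + n ℤ.- + m) (+ n)
    G≡ : gauss q A (+ m) ≡ G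
    G≡ = trans (gauss≡qbinomℤ qfac≢0 A (+ m)) (cong (λ t → qbinomℤ q (+ N ℤ.- t ℤ.- + m ℤ.+ 1ℤ) (+ m)) (ℤ.pos-* 3 n))
    H≡ : gauss (q ^ 3) C (+ n) ≡ H
    H≡ = trans (gauss≡qbinomℤ qfac³≢0 C (+ n)) (cong (λ t → qbinomℤ (q ^ 3) (+ N ℤ.- t ℤ.- + m) (+ n)) (ℤ.pos-* 2 n))
    regroup : ∀ s ζ X G H → s * ζ * X * G * H ≡ X * (s * (ζ * (G * H)))
    regroup = solve-∀ ℚ-ring

  F≡genSum : ∀ N → F x q N ≡ genSum x (suc N) N (summand q (+ N))
  F≡genSum N = sumTo-cong (λ m → sumTo-cong (term≡summand N m) N) (suc N)

  F-genSum : ∀ N d e → genSum x (d ℕ.+ suc N) (e ℕ.+ N) (summand q (+ N)) ≡ F x q N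
  F-genSum N d e =
    trans (genSum-support x (summand q (+ N)) (suc N) N (summand-supportₘ q N) (summand-supportₙ q N) d e)
          (sym (F≡genSum N))

  Fpred-genSum : ∀ M → genSum x (2 ℕ.+ M) (4 ℕ.+ M) (summand q (+ M ℤ.- 1ℤ)) ≡ Fpred x q M
  Fpred-genSum zero    = genSum-zero x (summand q (ℤ.- 1ℤ)) 2 4 (summand-at-minus-one q)
  Fpred-genSum (suc M) = F-genSum M 2 5

  genSum-summand-shift : ∀ M → genSum x (4 ℕ.+ M) (4 ℕ.+ M) (λ m n → summand q (+ M) (m ℤ.- 1ℤ) n) ≡ x * F x q M
  genSum-summand-shift M =
    trans (genSum-shiftₘ x (summand q (+ M)) (3 ℕ.+ M) (4 ℕ.+ M) (summand-negₘ q (+ M))) (cong (x *_) (F-genSum M 2 4))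

  genSum-summand-shift² : ∀ M →
    genSum x (4 ℕ.+ M) (4 ℕ.+ M) (λ m n → summand q (+ M ℤ.- 1ℤ) (m ℤ.- 1ℤ ℤ.- 1ℤ) n) ≡ x * (x * Fpred x q M)
  genSum-summand-shift² M = begin
    genSum x (4 ℕ.+ M) (4 ℕ.+ M) (λ m n → f (m ℤ.- 1ℤ ℤ.- 1ℤ) n)
      ≡⟨ genSum-shiftₘ x (λ m n → f (m ℤ.- 1ℤ) n) (3 ℕ.+ M) (4 ℕ.+ M) (λ k → summand-negₘ q N _) ⟩
    x * genSum x (3 ℕ.+ M) (4 ℕ.+ M) (λ m n → f (m ℤ.- 1ℤ) n)
      ≡⟨ cong (x *_) (genSum-shiftₘ x f (2 ℕ.+ M) (4 ℕ.+ M) (summand-negₘ q N)) ⟩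
    x * (x * genSum x (2 ℕ.+ M) (4 ℕ.+ M) f)
      ≡⟨ cong (λ u → x * (x * u)) (Fpred-genSum M) ⟩
    x * (x * Fpred x q M) ∎
    where
    open ≡-Reasoning
    N : ℤ
    f : ℤ → ℤ → ℚ
    N = + M ℤ.- 1ℤ
    f = summand q N

  F-four-term : q ≢ 0ℚ → ∀ M →
    F x q (suc M) - F x q M - q ^ suc M * (x * F x q M) + q ^ (M ℕ.+ suc M) * (x * (x * Fpred x q M)) ≡ 0ℚ
  F-four-term q≢0 M = begin
    F x q (suc M) - F x q M - q ^ suc M * (x * F x q M) + q ^ (M ℕ.+ suc M) * (x * (x * Fpred x q M))
      ≡⟨ sym (combination-cong (F-genSum (suc M) 2 3) (F-genSum M 3 4) (genSum-summand-shift M) (genSum-summand-shift² M)) ⟩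
    Σ (summand q N) - Σ (summand q (+ M))
      - q ^ suc M * Σ (λ m n → summand q (+ M) (m ℤ.- 1ℤ) n)
      + q ^ (M ℕ.+ suc M) * Σ (λ m n → summand q (+ M ℤ.- 1ℤ) (m ℤ.- 1ℤ ℤ.- 1ℤ) n)
      ≡⟨ genSum-four-term x q≢0 N (λ ()) (4 ℕ.+ M) (4 ℕ.+ M) ⟩
    Σ (λ m n → companion q N (m ℤ.- 1ℤ ℤ.- 1ℤ ℤ.- 1ℤ) n) - Σ (λ m n → companion q N m (n ℤ.- 1ℤ))
      ≡⟨ cong₂ _-_ (genSum-companion-shiftₘ x q M) (genSum-companion-shiftₙ x q M) ⟩
    x * (x * (x * companionSum x q M)) - x ^ 3 * companionSum x q M
      ≡⟨ cancel x (companionSum x q M) ⟩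
    0ℚ ∎
    where
    open ≡-Reasoning
    N : ℤ
    N = + suc M
    Σ : (ℤ → ℤ → ℚ) → ℚ
    Σ = genSum x (4 ℕ.+ M) (4 ℕ.+ M)
    combination-cong : ∀ {a a′ b b′ c c′ d d′} → a ≡ a′ → b ≡ b′ → c ≡ c′ → d ≡ d′ →
      a - b - q ^ suc M * c + q ^ (M ℕ.+ suc M) * d ≡ a′ - b′ - q ^ suc M * c′ + q ^ (M ℕ.+ suc M) * d′
    combination-cong refl refl refl refl = refl
    cancel : ∀ x H → x * (x * (x * H)) - x * (x * (x * 1ℚ)) * H ≡ 0ℚ
    cancel = solve-∀ ℚ-ring

  F-recurrence-q≢0 : q ≢ 0ℚ → ∀ M →
    F x q (suc M) ≡ (1ℚ + x * q ^ suc M) * F x q M - x ^ 2 * q ^ (M ℕ.+ suc M) * Fpred x q M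
  F-recurrence-q≢0 q≢0 M = begin
    F x q (suc M)
      ≡⟨ rearrange (F x q (suc M)) (F x q M) (Fpred x q M) x (q ^ suc M) (q ^ (M ℕ.+ suc M)) ⟩
    F x q (suc M) - F x q M - q ^ suc M * (x * F x q M) + q ^ (M ℕ.+ suc M) * (x * (x * Fpred x q M)) + rhs
      ≡⟨ cong (_+ rhs) (F-four-term q≢0 M) ⟩
    0ℚ + rhs
      ≡⟨ +-identityˡ rhs ⟩
    rhs ∎
    where
    open ≡-Reasoning
    rhs : ℚ
    rhs = (1ℚ + x * q ^ suc M) * F x q M - x ^ 2 * q ^ (M ℕ.+ suc M) * Fpred x q M
    rearrange : ∀ F₁ F₀ Fₚ x α β →
      F₁ ≡ F₁ - F₀ - α * (x * F₀) + β * (x * (x * Fₚ)) + ((1ℚ + x * α) * F₀ - x * (x * 1ℚ) * β * Fₚ)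
    rearrange = solve-∀ ℚ-ring

0^pos : ∀ e → 0 < e → 0ℚ ^ e ≡ 0ℚ
0^pos (suc e) _ = *-zeroˡ (0ℚ ^ e)

0^exponent : ∀ m n → 0 < m ℕ.+ n → 0ℚ ^ (binom2 (3 ℕ.* n ℕ.+ 1) ℕ.+ m ℕ.* m ℕ.+ 3 ℕ.* m ℕ.* n) ≡ 0ℚ
0^exponent (suc m) zero    _ = 0^pos (binom2 1 ℕ.+ suc m ℕ.* suc m ℕ.+ 3 ℕ.* suc m ℕ.* 0) (s≤s z≤n)
0^exponent m       (suc n) _ =
  trans (cong (λ b → 0ℚ ^ (b ℕ.+ m ℕ.* m ℕ.+ 3 ℕ.* m ℕ.* suc n)) (binom2-3n+1 (suc n)))
        (0^pos (3 ℕ.* suc n ℕ.* suc n ℕ.+ 3 ℕ.* triℕ (suc n) ℕ.+ m ℕ.* m ℕ.+ 3 ℕ.* m ℕ.* suc n) (s≤s z≤n))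

F-at-q≡0 : (∀ n → qfac 0ℚ n ≢ 0ℚ) → (∀ n → qfac (0ℚ ^ 3) n ≢ 0ℚ) → ∀ x N → F x 0ℚ N ≡ 1ℚ
F-at-q≡0 qfac≢0 qfac³≢0 x N = begin
  F x 0ℚ N
    ≡⟨ sumTo-head (λ m → sumTo-zero (λ n → term≡0 (suc m) n (s≤s z≤n)) N) (suc N) ⟩
  sumTo N (term x 0ℚ N 0)
    ≡⟨ sumTo-head (λ n → term≡0 0 (suc n) (s≤s z≤n)) N ⟩
  term x 0ℚ N 0 0
    ≡⟨ cong₂ (λ u v → (- 1ℚ) ^ 0 * 0ℚ ^ 0 * x ^ 0 * u * v)
             (gauss≡qbinomℤ qfac≢0 (+ N ℤ.- + (3 ℕ.* 0) ℤ.- + 0 ℤ.+ + 1) (+ 0))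
             (gauss≡qbinomℤ qfac³≢0 (+ N ℤ.- + (2 ℕ.* 0) ℤ.- + 0) (+ 0)) ⟩
  (- 1ℚ) ^ 0 * 0ℚ ^ 0 * x ^ 0 * 1ℚ * 1ℚ
    ≡⟨ refl ⟩
  1ℚ ∎
  where
  open ≡-Reasoning
  term≡0 : ∀ m n → 0 < m ℕ.+ n → term x 0ℚ N m n ≡ 0ℚ
  term≡0 m n pos = trans (cong (λ u → (- 1ℚ) ^ n * u * x ^ (m ℕ.+ 3 ℕ.* n) * G * H) (0^exponent m n pos))
                         (zeros ((- 1ℚ) ^ n) (x ^ (m ℕ.+ 3 ℕ.* n)) G H)
    where
    G H : ℚ
    G = gauss 0ℚ (+ N ℤ.- + (3 ℕ.* n) ℤ.- + m ℤ.+ + 1) (+ m)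
    H = gauss (0ℚ ^ 3) (+ N ℤ.- + (2 ℕ.* n) ℤ.- + m) (+ n)
    zeros : ∀ s X G H → s * 0ℚ * X * G * H ≡ 0ℚ
    zeros = solve-∀ ℚ-ring

F-recurrence-q≡0 : (∀ n → qfac 0ℚ n ≢ 0ℚ) → (∀ n → qfac (0ℚ ^ 3) n ≢ 0ℚ) → ∀ x M →
  F x 0ℚ (suc M) ≡ (1ℚ + x * 0ℚ ^ suc M) * F x 0ℚ M - x ^ 2 * 0ℚ ^ (M ℕ.+ suc M) * Fpred x 0ℚ M
F-recurrence-q≡0 qfac≢0 qfac³≢0 x M = begin
  F x 0ℚ (suc M)
    ≡⟨ F-at-q≡0 qfac≢0 qfac³≢0 x (suc M) ⟩
  1ℚ
    ≡⟨ constant x (x ^ 2) (0ℚ ^ M) (0ℚ ^ (M ℕ.+ M)) (Fpred x 0ℚ M) ⟩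
  (1ℚ + x * (0ℚ * 0ℚ ^ M)) * 1ℚ - x ^ 2 * (0ℚ * 0ℚ ^ (M ℕ.+ M)) * Fpred x 0ℚ M
    ≡⟨ cong₂ (λ u v → (1ℚ + x * 0ℚ ^ suc M) * u - x ^ 2 * 0ℚ ^ v * Fpred x 0ℚ M)
             (sym (F-at-q≡0 qfac≢0 qfac³≢0 x M)) (sym (ℕ.+-suc M M)) ⟩
  (1ℚ + x * 0ℚ ^ suc M) * F x 0ℚ M - x ^ 2 * 0ℚ ^ (M ℕ.+ suc M) * Fpred x 0ℚ M ∎
  where
  open ≡-Reasoning
  constant : ∀ x x² a b Fₚ → 1ℚ ≡ (1ℚ + x * (0ℚ * a)) * 1ℚ - x² * (0ℚ * b) * Fₚ
  constant = solve-∀ ℚ-ring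

F-recurrence : ∀ x q → (∀ n → qfac q n ≢ 0ℚ) → (∀ n → qfac (q ^ 3) n ≢ 0ℚ) → ∀ M →
  F x q (suc M) ≡ (1ℚ + x * q ^ suc M) * F x q M - x ^ 2 * q ^ (M ℕ.+ suc M) * Fpred x q M
F-recurrence x q qfac≢0 qfac³≢0 M with q ≟ 0ℚ
... | no q≢0   = F-recurrence-q≢0 x qfac≢0 qfac³≢0 q≢0 M
... | yes refl = F-recurrence-q≡0 qfac≢0 qfac³≢0 x M

-- The continued fraction

F-ratio : ∀ x q → (∀ n → qfac q n ≢ 0ℚ) → (∀ n → qfac (q ^ 3) n ≢ 0ℚ) →
  ∀ r → (∀ s → 1 ≤ s → s ≤ r → R x q s ≢ 0ℚ) → F x q (suc r) ≡ R x q (suc r) * F x q r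
F-ratio x q qfac≢0 qfac³≢0 zero _ =
  trans (F-recurrence x q qfac≢0 qfac³≢0 0) (simplify x (x ^ 2) q (q ^ 1) (F x q 0))
  where
  simplify : ∀ x x² q q¹ F₀ → (1ℚ + x * (q * 1ℚ)) * F₀ - x² * q¹ * 0ℚ ≡ (1ℚ + x * q) * F₀
  simplify = solve-∀ ℚ-ring
F-ratio x q qfac≢0 qfac³≢0 (suc r) R≢0 = begin
  F x q (2 ℕ.+ r)
    ≡⟨ F-recurrence x q qfac≢0 qfac³≢0 (suc r) ⟩
  (1ℚ + x * q ^ (2 ℕ.+ r)) * Fₛ - x ^ 2 * q ^ (suc r ℕ.+ (2 ℕ.+ r)) * F x q r
    ≡⟨ cong₂ (λ e u → (1ℚ + x * q ^ (2 ℕ.+ r)) * Fₛ - x ^ 2 * q ^ e * u) (exponent-sum r) F-prev ⟩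
  (1ℚ + x * q ^ (2 ℕ.+ r)) * Fₛ - x ^ 2 * q ^ (2 ℕ.* r ℕ.+ 3) * (inv Rₛ * Fₛ)
    ≡⟨ factor (x * q ^ (2 ℕ.+ r)) (x ^ 2 * q ^ (2 ℕ.* r ℕ.+ 3)) (inv Rₛ) Fₛ ⟩
  R x q (2 ℕ.+ r) * Fₛ ∎
  where
  open ≡-Reasoning
  Fₛ Rₛ : ℚ
  Fₛ = F x q (suc r)
  Rₛ = R x q (suc r)
  exponent-sum : ∀ r → suc r ℕ.+ (2 ℕ.+ r) ≡ 2 ℕ.* r ℕ.+ 3
  exponent-sum = ℕ-Solver.solve-∀
  ih : Fₛ ≡ Rₛ * F x q r
  ih = F-ratio x q qfac≢0 qfac³≢0 r (λ s 1≤s s≤r → R≢0 s 1≤s (ℕ.m≤n⇒m≤1+n s≤r))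
  F-prev : F x q r ≡ inv Rₛ * Fₛ
  F-prev = begin
    F x q r                   ≡⟨ sym (*-identityˡ _) ⟩
    1ℚ * F x q r              ≡⟨ cong (_* F x q r) (sym (*-invˡ Rₛ (R≢0 (suc r) (s≤s z≤n) ℕ.≤-refl))) ⟩
    inv Rₛ * Rₛ * F x q r     ≡⟨ *-assoc (inv Rₛ) Rₛ (F x q r) ⟩
    inv Rₛ * (Rₛ * F x q r)   ≡⟨ cong (inv Rₛ *_) (sym ih) ⟩
    inv Rₛ * Fₛ               ∎
    where
    *-invˡ : ∀ p → p ≢ 0ℚ → inv p * p ≡ 1ℚ
    *-invˡ p p≢0 = trans (*-comm (inv p) p) (*-invʳ p p≢0)
  factor : ∀ a b i F → (1ℚ + a) * F - b * (i * F) ≡ (1ℚ + a - b * i) * F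
  factor = solve-∀ ℚ-ring

corollary6p1 : (x q : ℚ) (N : ℕ) → 1 ≤ N
    → (∀ n → qfac q n ≢ 0ℚ)
    → (∀ n → qfac (q ^ 3) n ≢ 0ℚ)
    → (∀ r → 1 ≤ r → r < N → R x q r ≢ 0ℚ)
    → F x q (N ∸ 1) ≢ 0ℚ
    → F x q N * inv (F x q (N ∸ 1)) ≡ R x q N
corollary6p1 x q (suc N) _ qfac≢0 qfac³≢0 R≢0 F≢0 = begin
  F x q (suc N) * inv (F x q N)              ≡⟨ cong (_* inv (F x q N)) ratio ⟩
  R x q (suc N) * F x q N * inv (F x q N)    ≡⟨ *-assoc (R x q (suc N)) (F x q N) (inv (F x q N)) ⟩
  R x q (suc N) * (F x q N * inv (F x q N))  ≡⟨ cong (R x q (suc N) *_) (*-invʳ (F x q N) F≢0) ⟩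
  R x q (suc N) * 1ℚ                         ≡⟨ *-identityʳ (R x q (suc N)) ⟩
  R x q (suc N)                              ∎
  where
  open ≡-Reasoning
  ratio : F x q (suc N) ≡ R x q (suc N) * F x q N
  ratio = F-ratio x q qfac≢0 qfac³≢0 N (λ s 1≤s s≤N → R≢0 s 1≤s (s≤s s≤N))
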